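{- Let $n\ge 4$ and let $P(2n+1,1)$ be the graph with vertex set $\{u_0,\dots,u_{2n},v_0,\dots,v_{2n}\}$ and edges $u_iu_{i+1}$, $v_iv_{i+1}$, $u_iv_i$ ($i=0,\dots,2n$, indices mod $2n+1$). Up to switching isomorphism, the number of matchings of $P(2n+1,1)$ of size two is $4n-1$; that is, the matchings of size two of $P(2n+1,1)$, regarded as signatures, fall into exactly $4n-1$ classes under switching isomorphism.
   Context: A matching of size $k$ is a set of $k$ pairwise vertex-disjoint edges. A signature of a graph $G$ is a subset $\Sigma\subseteq E(G)$ (the negative edges). Resigning at a vertex $v$ replaces $\Sigma$ by its symmetric difference with the set of edges incident with $v$; two signatures are switching equivalent if one is obtained from the other by a sequence of resignings. Two signatures $\Sigma_1,\Sigma_2$ of $G$ are switching isomorphic if there is an automorphism $\psi$ of $G$ such that $\psi(\Sigma_1)=\{\psi(x)\psi(y):xy\in\Sigma_1\}$ is switching equivalent to $\Sigma_2$. -}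

module Defs where

open import Data.Nat using (ℕ; suc; _*_; _%_; _≡ᵇ_)
open import Data.Fin using (Fin; toℕ)
open import Data.Fin.Properties using () renaming (_≟_ to _≟F_)
open import Data.Bool using (Bool; true; false; _∧_; _∨_; not; _xor_)
open import Data.Product using (Σ; Σ-syntax; ∃; _×_; _,_; proj₁; proj₂)
open import Data.Product.Properties using (≡-dec)
open import Data.List using (List; []; _∷_)
open import Relation.Nullary.Decidable using (⌊_⌋; Dec)
open import Relation.Binary.PropositionalEquality using (_≡_; _≢_)
open import Function.Bundles using (_↔_; Inverse)

N : ℕ → ℕ
N n = suc (2 * n)

-- vertex (vtx 0 i) is u_i ; vertex (vtx 1 i) is v_i
record Vtx (n : ℕ) : Set where
  constructor vtx
  field
    side : Fin 2
    idx  : Fin (N n)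

eqV : ∀ {n} → Vtx n → Vtx n → Bool
eqV (vtx a i) (vtx b j) = ⌊ a ≟F b ⌋ ∧ ⌊ i ≟F j ⌋


isSucc : ∀ {n} → Fin (N n) → Fin (N n) → Bool
isSucc {n} i j = toℕ j ≡ᵇ (suc (toℕ i) % N n)

adj : ∀ {n} → Vtx n → Vtx n → Bool
adj {n} (vtx a i) (vtx b j) =
  (⌊ a ≟F b ⌋ ∧ (isSucc {n} i j ∨ isSucc {n} j i)) ∨ (not ⌊ a ≟F b ⌋ ∧ ⌊ i ≟F j ⌋)

-- A signature (set of negative edges) is represented by its indicator on
-- ordered pairs of vertices: Σ x y = true iff xy is a negative edge.
Sig : ℕ → Set
Sig n = Vtx n → Vtx n → Bool

_≐_ : ∀ {n} → Sig n → Sig n → Set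
Σ₁ ≐ Σ₂ = ∀ x y → Σ₁ x y ≡ Σ₂ x y

resign : ∀ {n} → Vtx n → Sig n → Sig n
resign v σ x y = σ x y xor (adj x y ∧ (eqV x v ∨ eqV y v))

resignAll : ∀ {n} → List (Vtx n) → Sig n → Sig n
resignAll []       σ = σ
resignAll (v ∷ vs) σ = resignAll vs (resign v σ)

SwitchEq : ∀ {n} → Sig n → Sig n → Set
SwitchEq {n} σ₁ σ₂ = Σ[ vs ∈ List (Vtx n) ] (resignAll vs σ₁ ≐ σ₂)

Aut : ℕ → Set
Aut n = Σ[ ψ ∈ Vtx n ↔ Vtx n ]
          (∀ x y → adj (Inverse.to ψ x) (Inverse.to ψ y) ≡ adj x y)

applyAut : ∀ {n} → Aut n → Sig n → Sig n
applyAut (ψ , _) σ x y = σ (Inverse.from ψ x) (Inverse.from ψ y)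

SwitchIso : ∀ {n} → Sig n → Sig n → Set
SwitchIso {n} σ₁ σ₂ = Σ[ ψ ∈ Aut n ] SwitchEq (applyAut ψ σ₁) σ₂

record Matching2 (n : ℕ) : Set where
  field
    a b c d : Vtx n
    ab-edge : adj a b ≡ true
    cd-edge : adj c d ≡ true
    a≢c : a ≢ c
    a≢d : a ≢ d
    b≢c : b ≢ c
    b≢d : b ≢ d

sigOf : ∀ {n} → Matching2 n → Sig n
sigOf M x y =
     (eqV x a ∧ eqV y b) ∨ (eqV x b ∧ eqV y a)
  ∨ ((eqV x c ∧ eqV y d) ∨ (eqV x d ∧ eqV y c))
  where open Matching2 M

module Submission where

-- Switching preserves the parity of the number of negative edges on every cycle; we use the
-- 2n + 1 squares and the outer cycle. For the signature of a matching {e₁, e₂} the odd squares are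
-- those containing an odd number of e₁, e₂ (a rim edge lies on one square, a spoke on two), and the
-- outer parity counts the edges on the outer cycle. An automorphism of P(2n+1,1) maps spokes to spokes, so it
-- acts on the indices by a rotation or a reflection and possibly exchanges the two cycles. These
-- symmetries, together with one resigning (two adjacent spokes are equivalent to two rim edges at
-- distance two), bring every matching to one of 4n − 1 normal forms: rim edges on opposite cycles at
-- offset 0…n, a spoke and an outer rim edge at offset 1…n, two outer rim edges at offset 2…n, two spokes
-- at offset 2…n. The number of odd squares, their position up to rotation and reflection and the outer
-- parity tell the normal forms apart.

open import Defs
open import Data.Nat using (ℕ; zero; suc; pred; _+_; _*_; _∸_; _%_; _≤_; _<_; z≤n; s≤s; _≤?_; _<?_)
open import Data.Nat.Properties
open import Data.Nat.DivMod using (m%n<n; n%n≡0; %-distribˡ-+; m%n%n≡m%n; m<n⇒m%n≡m; [m+kn]%n≡m%n; [m+n]%n≡m%n)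
open import Data.Fin using (Fin; toℕ; fromℕ<) renaming (zero to fzero; suc to fsuc)
open import Data.Fin.Properties using (toℕ-injective; toℕ<n; toℕ-fromℕ<) renaming (_≟_ to _≟F_)
open import Data.Bool using (Bool; true; false; _∧_; _∨_; not; _xor_)
open import Data.Bool.Properties using (∨-comm; ∨-assoc; ∧-comm; ∨-identityʳ; ∨-zeroʳ; ∧-zeroʳ; ∧-distribˡ-xor; xor-same; xor-identityʳ; xor-assoc; xor-comm; T-≡)
open import Data.Bool.Solver using (module xor-∧-Solver)
open import Data.Product using (Σ; Σ-syntax; _×_; _,_; proj₁; proj₂)
open import Data.Sum using (_⊎_; inj₁; inj₂)
open import Data.Empty using (⊥; ⊥-elim)
open import Data.List using (List; []; _∷_; _++_)
open import Data.List.Membership.Propositional using (_∈_; _∉_)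
open import Data.List.Relation.Unary.Any using (here; there)
open import Data.List.Relation.Unary.All using () renaming ([] to []ᵃ; _∷_ to _∷ᵃ_)
open import Data.List.Relation.Unary.All.Properties using (All¬⇒¬Any)
open import Data.List.Relation.Unary.Unique.Propositional using (Unique)
open import Data.List.Relation.Unary.AllPairs using () renaming ([] to []ᵖ; _∷_ to _∷ᵖ_)
open import Function using (_∘_)
open import Function.Bundles using (Inverse; Equivalence; mk↔ₛ′)
open import Function.Construct.Identity using (↔-id)
open import Function.Construct.Composition using (_↔-∘_)
open import Relation.Binary.PropositionalEquality
open import Relation.Nullary using (¬_; Dec; yes; no)
open import Relation.Nullary.Decidable using (⌊_⌋)

⌊⌋-yes : ∀ {p} {P : Set p} (d : Dec P) → P → ⌊ d ⌋ ≡ true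
⌊⌋-yes (yes _) _ = refl
⌊⌋-yes (no ¬p) p = ⊥-elim (¬p p)

⌊⌋-no : ∀ {p} {P : Set p} (d : Dec P) → ¬ P → ⌊ d ⌋ ≡ false
⌊⌋-no (yes p) ¬p = ⊥-elim (¬p p)
⌊⌋-no (no _) _ = refl

⌊⌋-sound : ∀ {p} {P : Set p} (d : Dec P) → ⌊ d ⌋ ≡ true → P
⌊⌋-sound (yes p) _ = p

≡-from-true⇔ : ∀ {a b : Bool} → (a ≡ true → b ≡ true) → (b ≡ true → a ≡ true) → a ≡ b
≡-from-true⇔ {false} {false} _ _ = refl
≡-from-true⇔ {false} {true}  _ g = g refl
≡-from-true⇔ {true}  {false} f _ = sym (f refl)
≡-from-true⇔ {true}  {true}  _ _ = refl

⌊≟⌋-sym : ∀ {k} (i j : Fin k) → ⌊ i ≟F j ⌋ ≡ ⌊ j ≟F i ⌋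
⌊≟⌋-sym i j = ≡-from-true⇔ (λ e → ⌊⌋-yes (j ≟F i) (sym (⌊⌋-sound (i ≟F j) e)))
                           (λ e → ⌊⌋-yes (i ≟F j) (sym (⌊⌋-sound (j ≟F i) e)))

-- The cyclic group of order k + 1

module Cyclic (k : ℕ) where

  next : Fin (suc k) → Fin (suc k)
  next i = fromℕ< (m%n<n (suc (toℕ i)) (suc k))

  rotate : ℕ → Fin (suc k) → Fin (suc k)
  rotate zero    i = i
  rotate (suc t) i = next (rotate t i)

  prev : Fin (suc k) → Fin (suc k)
  prev = rotate k

  residue : ℕ → Fin (suc k)
  residue t = rotate t fzero

  [m%d+n]%d≡[m+n]%d : ∀ a b → (a % suc k + b) % suc k ≡ (a + b) % suc k
  [m%d+n]%d≡[m+n]%d a b = begin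
    (a % suc k + b) % suc k                  ≡⟨ %-distribˡ-+ (a % suc k) b (suc k) ⟩
    (a % suc k % suc k + b % suc k) % suc k  ≡⟨ cong (λ z → (z + b % suc k) % suc k) (m%n%n≡m%n a (suc k)) ⟩
    (a % suc k + b % suc k) % suc k          ≡⟨ %-distribˡ-+ a b (suc k) ⟨
    (a + b) % suc k                          ∎
    where open ≡-Reasoning

  toℕ-rotate : ∀ t i → toℕ (rotate t i) ≡ (toℕ i + t) % suc k
  toℕ-rotate zero    i = sym (trans (cong (_% suc k) (+-identityʳ (toℕ i))) (m<n⇒m%n≡m (toℕ<n i)))
  toℕ-rotate (suc t) i = begin
    toℕ (next (rotate t i))           ≡⟨ toℕ-fromℕ< _ ⟩
    suc (toℕ (rotate t i)) % suc k    ≡⟨ cong (λ z → suc z % suc k) (toℕ-rotate t i) ⟩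
    (1 + (toℕ i + t) % suc k) % suc k ≡⟨ cong (_% suc k) (+-comm 1 _) ⟩
    ((toℕ i + t) % suc k + 1) % suc k ≡⟨ [m%d+n]%d≡[m+n]%d (toℕ i + t) 1 ⟩
    (toℕ i + t + 1) % suc k           ≡⟨ cong (_% suc k) (trans (+-assoc (toℕ i) t 1) (cong (toℕ i +_) (+-comm t 1))) ⟩
    (toℕ i + suc t) % suc k           ∎
    where open ≡-Reasoning

  rotate-+ : ∀ s t i → rotate s (rotate t i) ≡ rotate (s + t) i
  rotate-+ zero    t i = refl
  rotate-+ (suc s) t i = cong next (rotate-+ s t i)

  rotate-comm : ∀ s t i → rotate s (rotate t i) ≡ rotate t (rotate s i)
  rotate-comm s t i = trans (rotate-+ s t i) (trans (cong (λ z → rotate z i) (+-comm s t)) (sym (rotate-+ t s i)))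

  rotate-cong : ∀ s t i → s % suc k ≡ t % suc k → rotate s i ≡ rotate t i
  rotate-cong s t i e = toℕ-injective (begin
    toℕ (rotate s i)                    ≡⟨ toℕ-rotate s i ⟩
    (toℕ i + s) % suc k                 ≡⟨ %-distribˡ-+ (toℕ i) s (suc k) ⟩
    (toℕ i % suc k + s % suc k) % suc k ≡⟨ cong (λ z → (toℕ i % suc k + z) % suc k) e ⟩
    (toℕ i % suc k + t % suc k) % suc k ≡⟨ %-distribˡ-+ (toℕ i) t (suc k) ⟨
    (toℕ i + t) % suc k                 ≡⟨ toℕ-rotate t i ⟨
    toℕ (rotate t i)                    ∎)
    where open ≡-Reasoning

  -- k * t is the additive inverse of t modulo k + 1.
  rotate-inverseˡ : ∀ t i → rotate (k * t) (rotate t i) ≡ i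
  rotate-inverseˡ t i = trans (rotate-+ (k * t) t i) (rotate-cong (k * t + t) 0 i (begin
    (k * t + t) % suc k     ≡⟨ cong (_% suc k) (trans (+-comm (k * t) t) (*-comm (suc k) t)) ⟩
    (0 + t * suc k) % suc k ≡⟨ [m+kn]%n≡m%n 0 t (suc k) ⟩
    0                       ∎))
    where open ≡-Reasoning

  rotate-inverseʳ : ∀ t i → rotate t (rotate (k * t) i) ≡ i
  rotate-inverseʳ t i = trans (rotate-comm t (k * t) i) (rotate-inverseˡ t i)

  rotate-injective : ∀ t {i j} → rotate t i ≡ rotate t j → i ≡ j
  rotate-injective t {i} {j} e = trans (sym (rotate-inverseˡ t i)) (trans (cong (rotate (k * t)) e) (rotate-inverseˡ t j))

  prev-next : ∀ i → prev (next i) ≡ i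
  prev-next i = trans (rotate-+ k 1 i) (rotate-cong (k + 1) 0 i (trans (cong (_% suc k) (+-comm k 1)) (n%n≡0 (suc k))))

  next-prev : ∀ i → next (prev i) ≡ i
  next-prev i = trans (rotate-comm 1 k i) (prev-next i)

  toℕ-residue : ∀ t → toℕ (residue t) ≡ t % suc k
  toℕ-residue t = toℕ-rotate t fzero

  residue-toℕ : ∀ i → residue (toℕ i) ≡ i
  residue-toℕ i = toℕ-injective (trans (toℕ-residue (toℕ i)) (m<n⇒m%n≡m (toℕ<n i)))

  rotate-toℕ : ∀ i → rotate (k * toℕ i) i ≡ fzero
  rotate-toℕ i = trans (cong (rotate (k * toℕ i)) (sym (residue-toℕ i))) (rotate-inverseˡ (toℕ i) fzero)

  rotate-% : ∀ s t i → rotate s i ≡ rotate t i → s % suc k ≡ t % suc k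
  rotate-% s t i e = trans (sym (toℕ-residue s)) (trans (cong toℕ (begin
    rotate s fzero                     ≡⟨ cong (rotate s) (rotate-toℕ i) ⟨
    rotate s (rotate (k * toℕ i) i)    ≡⟨ rotate-comm s (k * toℕ i) i ⟩
    rotate (k * toℕ i) (rotate s i)    ≡⟨ cong (rotate (k * toℕ i)) e ⟩
    rotate (k * toℕ i) (rotate t i)    ≡⟨ rotate-comm (k * toℕ i) t i ⟩
    rotate t (rotate (k * toℕ i) i)    ≡⟨ cong (rotate t) (rotate-toℕ i) ⟩
    rotate t fzero                     ∎)) (toℕ-residue t))
    where open ≡-Reasoning

  rotate-≢ : ∀ {s t} i → s < suc k → t < suc k → s ≢ t → rotate s i ≢ rotate t i
  rotate-≢ {s} {t} i s< t< s≢t e = s≢t (trans (sym (m<n⇒m%n≡m s<)) (trans (rotate-% s t i e) (m<n⇒m%n≡m t<)))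

  residue-injective : ∀ {s t} → s < suc k → t < suc k → residue s ≡ residue t → s ≡ t
  residue-injective {s} {t} s< t< e = trans (sym (m<n⇒m%n≡m s<)) (trans (rotate-% s t fzero e) (m<n⇒m%n≡m t<))

  reflect : Fin (suc k) → Fin (suc k)
  reflect i = residue (k * toℕ i)

  rotate-reflect : ∀ i → rotate (toℕ i) (reflect i) ≡ fzero
  rotate-reflect i = rotate-inverseʳ (toℕ i) fzero

  reflect-unique : ∀ i j → rotate (toℕ i) j ≡ fzero → j ≡ reflect i
  reflect-unique i j e = rotate-injective (toℕ i) (trans e (sym (rotate-reflect i)))

  rotate-toℕ-sym : ∀ i j → rotate (toℕ i) j ≡ rotate (toℕ j) i
  rotate-toℕ-sym i j = begin
    rotate (toℕ i) j                     ≡⟨ cong (rotate (toℕ i)) (residue-toℕ j) ⟨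
    rotate (toℕ i) (rotate (toℕ j) fzero) ≡⟨ rotate-comm (toℕ i) (toℕ j) fzero ⟩
    rotate (toℕ j) (rotate (toℕ i) fzero) ≡⟨ cong (rotate (toℕ j)) (residue-toℕ i) ⟩
    rotate (toℕ j) i                     ∎
    where open ≡-Reasoning

  reflect-involutive : ∀ i → reflect (reflect i) ≡ i
  reflect-involutive i = sym (reflect-unique (reflect i) i (trans (sym (rotate-toℕ-sym i (reflect i))) (rotate-reflect i)))

  reflect-next : ∀ i → reflect (next i) ≡ prev (reflect i)
  reflect-next i = sym (reflect-unique (next i) (prev (reflect i)) (begin
    rotate (toℕ (next i)) (prev (reflect i))  ≡⟨ rotate-cong (toℕ (next i)) (toℕ i + 1) _ (trans (cong (_% suc k) (toℕ-rotate 1 i)) (m%n%n≡m%n (toℕ i + 1) (suc k))) ⟩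
    rotate (toℕ i + 1) (prev (reflect i))     ≡⟨ cong (λ z → rotate z (prev (reflect i))) (+-comm (toℕ i) 1) ⟩
    rotate (1 + toℕ i) (prev (reflect i))     ≡⟨ rotate-+ 1 (toℕ i) _ ⟨
    next (rotate (toℕ i) (prev (reflect i)))  ≡⟨ rotate-comm 1 (toℕ i) _ ⟩
    rotate (toℕ i) (next (prev (reflect i)))  ≡⟨ cong (rotate (toℕ i)) (next-prev (reflect i)) ⟩
    rotate (toℕ i) (reflect i)                ≡⟨ rotate-reflect i ⟩
    fzero                                     ∎))
    where open ≡-Reasoning

  reflect-prev : ∀ i → reflect (prev i) ≡ next (reflect i)
  reflect-prev i = begin
    reflect (prev i)                       ≡⟨ next-prev _ ⟨
    next (prev (reflect (prev i)))         ≡⟨ cong next (reflect-next (prev i)) ⟨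
    next (reflect (next (prev i)))         ≡⟨ cong (λ z → next (reflect z)) (next-prev i) ⟩
    next (reflect i)                       ∎
    where open ≡-Reasoning

  reflect-zero : reflect fzero ≡ fzero
  reflect-zero = sym (reflect-unique fzero fzero refl)

  rotate-toℕ-residue : ∀ δ i → rotate (toℕ (residue δ)) i ≡ rotate δ i
  rotate-toℕ-residue δ i = rotate-cong (toℕ (residue δ)) δ i (trans (cong (_% suc k) (toℕ-residue δ)) (m%n%n≡m%n δ (suc k)))

  prev-reflect-residue : ∀ δ → δ ≤ k → prev (reflect (residue δ)) ≡ residue (k ∸ δ)
  prev-reflect-residue δ δ≤k = trans (cong prev (sym (reflect-unique (residue δ) (residue (suc (k ∸ δ))) (begin
    rotate (toℕ (residue δ)) (residue (suc (k ∸ δ))) ≡⟨ rotate-toℕ-residue δ _ ⟩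
    rotate δ (residue (suc (k ∸ δ)))                 ≡⟨ rotate-+ δ (suc (k ∸ δ)) fzero ⟩
    residue (δ + suc (k ∸ δ))                        ≡⟨ cong residue (trans (+-suc δ _) (cong suc (m+[n∸m]≡n δ≤k))) ⟩
    residue (suc k)                                  ≡⟨ rotate-cong (suc k) 0 fzero ([m+n]%n≡m%n 0 (suc k)) ⟩
    fzero                                            ∎)))) (prev-next (residue (k ∸ δ)))
    where open ≡-Reasoning

  residue-≡ : ∀ a b → a < suc k + suc k → b < suc k → residue a ≡ residue b → a ≡ b ⊎ a ≡ b + suc k
  residue-≡ a b a< b< e with a <? suc k
  ... | yes a<1+k = inj₁ (trans (sym (m<n⇒m%n≡m a<1+k)) (trans (rotate-% a b fzero e) (m<n⇒m%n≡m b<)))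
  ... | no a≮1+k = inj₂ (trans (sym (m∸n+n≡m 1+k≤a)) (cong (_+ suc k) a∸1+k≡b))
    where
      1+k≤a : suc k ≤ a
      1+k≤a = ≮⇒≥ a≮1+k
      a∸1+k< : a ∸ suc k < suc k
      a∸1+k< = +-cancelʳ-< (suc k) (a ∸ suc k) (suc k) (subst (_< suc k + suc k) (sym (m∸n+n≡m 1+k≤a)) a<)
      a∸1+k≡b : a ∸ suc k ≡ b
      a∸1+k≡b = trans (sym (m<n⇒m%n≡m a∸1+k<)) (trans (sym ([m+n]%n≡m%n (a ∸ suc k) (suc k)))
                  (trans (cong (_% suc k) (m∸n+n≡m 1+k≤a)) (trans (rotate-% a b fzero e) (m<n⇒m%n≡m b<))))

  rotate-residue : ∀ c d → rotate c (residue d) ≡ residue (c + d)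
  rotate-residue c d = rotate-+ c d fzero

  module _ (2≤k : 2 ≤ k) where

    next-≢ : ∀ i → next i ≢ i
    next-≢ i = rotate-≢ i (s≤s (≤-trans (s≤s z≤n) 2≤k)) (s≤s z≤n) (λ ())

    next²-≢ : ∀ i → next (next i) ≢ i
    next²-≢ i = rotate-≢ i (s≤s 2≤k) (s≤s z≤n) (λ ())

    next-≢-prev : ∀ i → next i ≢ prev i
    next-≢-prev i = rotate-≢ i (s≤s (≤-trans (s≤s z≤n) 2≤k)) ≤-refl (<⇒≢ 2≤k)

-- Parities

xorSum : ∀ {k} → (Fin k → Bool) → Bool
xorSum {zero}  f = false
xorSum {suc k} f = f fzero xor xorSum (f ∘ fsuc)

xorSum-cong : ∀ {k} {f g : Fin k → Bool} → (∀ i → f i ≡ g i) → xorSum f ≡ xorSum g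
xorSum-cong {zero}  e = refl
xorSum-cong {suc k} e = cong₂ _xor_ (e fzero) (xorSum-cong (e ∘ fsuc))

open xor-∧-Solver using (solve; _:+_; _:=_)

xor-interchange : ∀ a b c d → (a xor b) xor (c xor d) ≡ (a xor c) xor (b xor d)
xor-interchange = solve 4 (λ a b c d → (a :+ b) :+ (c :+ d) := (a :+ c) :+ (b :+ d)) refl

xorSum-xor : ∀ {k} (f g : Fin k → Bool) → xorSum (λ i → f i xor g i) ≡ xorSum f xor xorSum g
xorSum-xor {zero}  f g = refl
xorSum-xor {suc k} f g = trans (cong ((f fzero xor g fzero) xor_) (xorSum-xor (f ∘ fsuc) (g ∘ fsuc)))
  (xor-interchange (f fzero) (g fzero) _ _)

xorSum-∧ˡ : ∀ {k} c (f : Fin k → Bool) → xorSum (λ i → c ∧ f i) ≡ c ∧ xorSum f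
xorSum-∧ˡ {zero}  c f = sym (∧-zeroʳ c)
xorSum-∧ˡ {suc k} c f = trans (cong ((c ∧ f fzero) xor_) (xorSum-∧ˡ c (f ∘ fsuc))) (sym (∧-distribˡ-xor c (f fzero) _))

xorSum-false : ∀ {k} → xorSum {k} (λ _ → false) ≡ false
xorSum-false {zero}  = refl
xorSum-false {suc k} = xorSum-false {k}

xorSum-indicator : ∀ {k} (j : Fin k) → xorSum (λ i → ⌊ i ≟F j ⌋) ≡ true
xorSum-indicator {suc k} fzero    = cong not (xorSum-false {k})
xorSum-indicator {suc k} (fsuc j) = trans (xorSum-cong (λ i → ⌊⌋-map-suc i j)) (xorSum-indicator j)
  where ⌊⌋-map-suc : ∀ {k} (i j : Fin k) → ⌊ fsuc i ≟F fsuc j ⌋ ≡ ⌊ i ≟F j ⌋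
        ⌊⌋-map-suc i j with i ≟F j
        ... | yes _ = refl
        ... | no _  = refl

xor-distrib₄ : ∀ a b c d a′ b′ c′ d′ → (a xor a′) xor ((b xor b′) xor ((c xor c′) xor (d xor d′)))
                                   ≡ (a xor (b xor (c xor d))) xor (a′ xor (b′ xor (c′ xor d′)))
xor-distrib₄ = solve 8 (λ a b c d a′ b′ c′ d′ → (a :+ a′) :+ ((b :+ b′) :+ ((c :+ c′) :+ (d :+ d′)))
                                              := (a :+ (b :+ (c :+ d))) :+ (a′ :+ (b′ :+ (c′ :+ d′)))) refl

∧-false : ∀ {a b} → (a ≡ true → b ≡ true → ⊥) → a ∧ b ≡ false
∧-false {false} _ = refl
∧-false {true} {false} _ = refl
∧-false {true} {true} f = ⊥-elim (f refl refl)

∨≡xor : ∀ a b → a ∧ b ≡ false → a ∨ b ≡ a xor b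
∨≡xor false b _ = refl
∨≡xor true false _ = refl

-- A 4-cycle meets every vertex star in an even number of edges.
xor-4cycle : ∀ a b c d → (a xor b) xor ((c xor d) xor ((a xor c) xor (b xor d))) ≡ false
xor-4cycle a b c d = trans (solve 4 (λ a b c d → (a :+ b) :+ ((c :+ d) :+ ((a :+ c) :+ (b :+ d)))
                                              := ((a :+ b) :+ (c :+ d)) :+ ((a :+ b) :+ (c :+ d))) refl a b c d)
                           (xor-same ((a xor b) xor (c xor d)))

-- The prism P(2n+1,1) and its automorphisms

pattern outer = fzero
pattern inner = fsuc fzero

other : Fin 2 → Fin 2
other outer = inner
other inner = outer

other-involutive : ∀ s → other (other s) ≡ s
other-involutive outer = refl
other-involutive inner = refl

other-≢ : ∀ s → s ≢ other s
other-≢ outer ()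
other-≢ inner ()

module Prism (n : ℕ) where

  open Cyclic (2 * n) public

  I : Set
  I = Fin (N n)

  V : Set
  V = Vtx n

  spokeMate rimNext rimPrev : V → V
  spokeMate (vtx s i) = vtx (other s) i
  rimNext   (vtx s i) = vtx s (next i)
  rimPrev   (vtx s i) = vtx s (prev i)

  isSucc-next : ∀ i → isSucc {n} i (next i) ≡ true
  isSucc-next i = Equivalence.to T-≡ (≡⇒≡ᵇ (toℕ (next i)) (suc (toℕ i) % N n) (toℕ-fromℕ< _))

  isSucc⇒next : ∀ i j → isSucc {n} i j ≡ true → j ≡ next i
  isSucc⇒next i j e = toℕ-injective (trans (≡ᵇ⇒≡ (toℕ j) (suc (toℕ i) % N n) (Equivalence.from T-≡ e)) (sym (toℕ-fromℕ< _)))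

  alongRim : ∀ s i j → (isSucc {n} i j ∨ isSucc {n} j i) ≡ true → vtx {n} s j ≡ vtx s (next i) ⊎ vtx {n} s j ≡ vtx s (prev i)
  alongRim s i j e with isSucc {n} i j in succ
  ... | true  = inj₁ (cong (vtx s) (isSucc⇒next i j succ))
  ... | false = inj₂ (cong (vtx s) (trans (sym (prev-next j)) (cong prev (sym (isSucc⇒next j i e)))))

  adj⇒neighbour : ∀ (x y : V) → adj x y ≡ true → y ≡ spokeMate x ⊎ y ≡ rimNext x ⊎ y ≡ rimPrev x
  adj⇒neighbour (vtx outer i) (vtx outer j) e = inj₂ (alongRim outer i j (trans (sym (∨-identityʳ _)) e))
  adj⇒neighbour (vtx inner i) (vtx inner j) e = inj₂ (alongRim inner i j (trans (sym (∨-identityʳ _)) e))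
  adj⇒neighbour (vtx outer i) (vtx inner j) e = inj₁ (cong (vtx inner) (sym (⌊⌋-sound (i ≟F j) e)))
  adj⇒neighbour (vtx inner i) (vtx outer j) e = inj₁ (cong (vtx outer) (sym (⌊⌋-sound (i ≟F j) e)))

  adj-spokeMate : ∀ (x : V) → adj x (spokeMate x) ≡ true
  adj-spokeMate (vtx outer i) = ⌊⌋-yes (i ≟F i) refl
  adj-spokeMate (vtx inner i) = ⌊⌋-yes (i ≟F i) refl

  adj-rimNext : ∀ (x : V) → adj x (rimNext x) ≡ true
  adj-rimNext (vtx outer i) = cong (λ b → (b ∨ isSucc {n} (next i) i) ∨ false) (isSucc-next i)
  adj-rimNext (vtx inner i) = cong (λ b → (b ∨ isSucc {n} (next i) i) ∨ false) (isSucc-next i)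

  alongRimPrev : ∀ i → (isSucc {n} i (prev i) ∨ isSucc {n} (prev i) i) ∨ false ≡ true
  alongRimPrev i = trans (∨-identityʳ _) (trans (cong (isSucc {n} i (prev i) ∨_)
    (subst (λ j → isSucc {n} (prev i) j ≡ true) (next-prev i) (isSucc-next (prev i)))) (∨-zeroʳ _))

  adj-rimPrev : ∀ (x : V) → adj x (rimPrev x) ≡ true
  adj-rimPrev (vtx outer i) = alongRimPrev i
  adj-rimPrev (vtx inner i) = alongRimPrev i

  adj-sym : ∀ (x y : V) → adj x y ≡ adj y x
  adj-sym (vtx a i) (vtx b j) rewrite ⌊≟⌋-sym a b | ⌊≟⌋-sym i j
    = cong (λ c → (⌊ b ≟F a ⌋ ∧ c) ∨ (not ⌊ b ≟F a ⌋ ∧ ⌊ j ≟F i ⌋)) (∨-comm (isSucc {n} i j) (isSucc {n} j i))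

  eqV-sound : ∀ (x y : V) → eqV {n} x y ≡ true → x ≡ y
  eqV-sound (vtx a i) (vtx b j) e with a ≟F b | i ≟F j
  ... | yes refl | yes refl = refl

  eqV-refl : ∀ (x : V) → eqV {n} x x ≡ true
  eqV-refl (vtx a i) = cong₂ _∧_ (⌊⌋-yes (a ≟F a) refl) (⌊⌋-yes (i ≟F i) refl)

  NeighbourPreserving : (V → V) → Set
  NeighbourPreserving f = ∀ x → adj (f x) (f (spokeMate x)) ≡ true × adj (f x) (f (rimNext x)) ≡ true × adj (f x) (f (rimPrev x)) ≡ true

  adj-preserved : ∀ f → NeighbourPreserving f → ∀ (x y : V) → adj x y ≡ true → adj (f x) (f y) ≡ true
  adj-preserved f pf x y e with adj⇒neighbour x y e
  ... | inj₁ refl        = proj₁ (pf x)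
  ... | inj₂ (inj₁ refl) = proj₁ (proj₂ (pf x))
  ... | inj₂ (inj₂ refl) = proj₂ (proj₂ (pf x))

  mkAut : (f g : V → V) → (∀ x → f (g x) ≡ x) → (∀ x → g (f x) ≡ x) → NeighbourPreserving f → NeighbourPreserving g → Aut n
  mkAut f g fg gf pf pg = mk↔ₛ′ f g fg gf , λ x y → ≡-from-true⇔
    (λ e → subst₂ (λ a b → adj a b ≡ true) (gf x) (gf y) (adj-preserved g pg (f x) (f y) e))
    (adj-preserved f pf x y)

  toᴬ fromᴬ : Aut n → V → V
  toᴬ ψ = Inverse.to (proj₁ ψ)
  fromᴬ ψ = Inverse.from (proj₁ ψ)

  idᴬ : Aut n
  idᴬ = ↔-id V , λ _ _ → refl

  _∘ᴬ_ : Aut n → Aut n → Aut n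
  (ψ , ψ-adj) ∘ᴬ (φ , φ-adj) = ψ ↔-∘ φ , λ x y → trans (ψ-adj _ _) (φ-adj x y)

  rotateV : ℕ → V → V
  rotateV t (vtx s i) = vtx s (rotate t i)

  rotateV-preserving : ∀ t → NeighbourPreserving (rotateV t)
  rotateV-preserving t (vtx s i) = adj-spokeMate (vtx s (rotate t i))
    , subst (λ j → adj (vtx {n} s (rotate t i)) (vtx s j) ≡ true) (rotate-comm 1 t i) (adj-rimNext (vtx s (rotate t i)))
    , subst (λ j → adj (vtx {n} s (rotate t i)) (vtx s j) ≡ true) (rotate-comm (2 * n) t i) (adj-rimPrev (vtx s (rotate t i)))

  rotateᴬ : ℕ → Aut n
  rotateᴬ t = mkAut (rotateV t) (rotateV (2 * n * t))
    (λ { (vtx s i) → cong (vtx s) (rotate-inverseʳ t i) }) (λ { (vtx s i) → cong (vtx s) (rotate-inverseˡ t i) })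
    (rotateV-preserving t) (rotateV-preserving (2 * n * t))

  spokeMate-involutive : ∀ x → spokeMate (spokeMate x) ≡ x
  spokeMate-involutive (vtx s i) = cong (λ t → vtx t i) (other-involutive s)

  spokeMate-preserving : NeighbourPreserving spokeMate
  spokeMate-preserving (vtx s i) = adj-spokeMate (vtx (other s) i) , adj-rimNext (vtx (other s) i) , adj-rimPrev (vtx (other s) i)

  swapᴬ : Aut n
  swapᴬ = mkAut spokeMate spokeMate spokeMate-involutive spokeMate-involutive spokeMate-preserving spokeMate-preserving

  reflectV : V → V
  reflectV (vtx s i) = vtx s (reflect i)

  reflectV-preserving : NeighbourPreserving reflectV
  reflectV-preserving (vtx s i) = adj-spokeMate (vtx s (reflect i))
    , subst (λ j → adj (vtx {n} s (reflect i)) (vtx s j) ≡ true) (sym (reflect-next i)) (adj-rimPrev (vtx s (reflect i)))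
    , subst (λ j → adj (vtx {n} s (reflect i)) (vtx s j) ≡ true) (sym (reflect-prev i)) (adj-rimNext (vtx s (reflect i)))

  reflectᴬ : Aut n
  reflectᴬ = mkAut reflectV reflectV inv inv reflectV-preserving reflectV-preserving
    where inv : ∀ x → reflectV (reflectV x) ≡ x
          inv (vtx s i) = cong (vtx s) (reflect-involutive i)

-- Edges, signatures and switching invariants

2≢2n∸1 : ∀ n → 2 ≢ 2 * n ∸ 1
2≢2n∸1 (suc (suc (suc n))) e = m+1+n≢0 n (sym (suc-injective (suc-injective e)))

module Edges (n : ℕ) (1≤n : 1 ≤ n) where

  open Prism n public

  2≤2n : 2 ≤ 2 * n
  2≤2n = *-monoʳ-≤ 2 1≤n

  next²-≢-prev² : ∀ i → next (next i) ≢ prev (prev i)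
  next²-≢-prev² i e = rotate-≢ i (s≤s 2≤2n) (s≤s (m∸n≤m (2 * n) 1)) (2≢2n∸1 n) (trans e (begin
    rotate (2 * n) (rotate (2 * n) i) ≡⟨ rotate-+ (2 * n) (2 * n) i ⟩
    rotate (2 * n + 2 * n) i          ≡⟨ rotate-cong (2 * n + 2 * n) (2 * n ∸ 1) i (trans (cong (_% N n) 2n+2n) ([m+n]%n≡m%n (2 * n ∸ 1) (N n))) ⟩
    rotate (2 * n ∸ 1) i              ∎))
    where
      open ≡-Reasoning
      2n+2n : 2 * n + 2 * n ≡ 2 * n ∸ 1 + N n
      2n+2n = trans (cong (_+ 2 * n) (sym (m∸n+n≡m (≤-trans (s≤s z≤n) 2≤2n)))) (+-assoc (2 * n ∸ 1) 1 (2 * n))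

  data Edge : Set where
    rim   : Fin 2 → I → Edge
    spoke : I → Edge

  tail head : Edge → V
  tail (rim s i) = vtx s i
  tail (spoke i) = vtx outer i
  head (rim s i) = vtx s (next i)
  head (spoke i) = vtx inner i

  adj-tail-head : ∀ e → adj (tail e) (head e) ≡ true
  adj-tail-head (rim s i) = adj-rimNext (vtx s i)
  adj-tail-head (spoke i) = adj-spokeMate (vtx outer i)

  tail≢head : ∀ e → tail e ≢ head e
  tail≢head (rim s i) e = next-≢ 2≤2n i (sym (cong Vtx.idx e))
  tail≢head (spoke i) ()

  Joins : V → V → Edge → Set
  Joins a b e = (a ≡ tail e × b ≡ head e) ⊎ (a ≡ head e × b ≡ tail e)

  adj⇒edge : ∀ a b → adj a b ≡ true → Σ Edge (Joins a b)
  adj⇒edge (vtx s i) b e with adj⇒neighbour (vtx s i) b e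
  adj⇒edge (vtx outer i) b e | inj₁ refl = spoke i , inj₁ (refl , refl)
  adj⇒edge (vtx inner i) b e | inj₁ refl = spoke i , inj₂ (refl , refl)
  ... | inj₂ (inj₁ refl) = rim s i , inj₁ (refl , refl)
  ... | inj₂ (inj₂ refl) = rim s (prev i) , inj₂ (cong (vtx s) (sym (next-prev i)) , refl)

  ends-injective : ∀ e e′ → tail e ≡ tail e′ → head e ≡ head e′ → e ≡ e′
  ends-injective (rim s i) (rim .s .i) refl _ = refl
  ends-injective (spoke i) (spoke .i) refl _ = refl
  ends-injective (rim outer i) (spoke .i) refl ()
  ends-injective (spoke i) (rim outer .i) refl ()

  ends-not-crossed : ∀ e e′ → tail e ≡ head e′ → head e ≡ tail e′ → ⊥
  ends-not-crossed (rim s i) (rim s′ j) t h = next²-≢ 2≤2n j (trans (cong next (sym (cong Vtx.idx t))) (cong Vtx.idx h))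
  ends-not-crossed (rim outer i) (spoke j) () _
  ends-not-crossed (rim inner i) (spoke j) _ ()
  ends-not-crossed (spoke i) (rim outer j) _ ()
  ends-not-crossed (spoke i) (rim inner j) () _
  ends-not-crossed (spoke i) (spoke j) () _

  eqE : Edge → Edge → Bool
  eqE (rim s i) (rim s′ j) = ⌊ s ≟F s′ ⌋ ∧ ⌊ i ≟F j ⌋
  eqE (spoke i) (spoke j)  = ⌊ i ≟F j ⌋
  eqE _ _                  = false

  eqE-sound : ∀ e e′ → eqE e e′ ≡ true → e ≡ e′
  eqE-sound (rim s i) (rim s′ j) e with s ≟F s′ | i ≟F j
  ... | yes refl | yes refl = refl
  eqE-sound (spoke i) (spoke j) e = cong spoke (⌊⌋-sound (i ≟F j) e)

  eqE-refl : ∀ e → eqE e e ≡ true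
  eqE-refl (rim s i) = cong₂ _∧_ (⌊⌋-yes (s ≟F s) refl) (⌊⌋-yes (i ≟F i) refl)
  eqE-refl (spoke i) = ⌊⌋-yes (i ≟F i) refl

  pairSig : V → V → Sig n
  pairSig p q x y = (eqV x p ∧ eqV y q) ∨ (eqV x q ∧ eqV y p)

  pairSig-true : ∀ p q x y → pairSig p q x y ≡ true → (x ≡ p × y ≡ q) ⊎ (x ≡ q × y ≡ p)
  pairSig-true p q x y e with eqV x p in xp | eqV y q in yq | eqV x q in xq | eqV y p in yp
  ... | true  | true  | _    | _    = inj₁ (eqV-sound x p xp , eqV-sound y q yq)
  ... | true  | false | true | true = inj₂ (eqV-sound x q xq , eqV-sound y p yp)
  ... | false | _     | true | true = inj₂ (eqV-sound x q xq , eqV-sound y p yp)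

  pairSig-at : ∀ p q → pairSig p q p q ≡ true
  pairSig-at p q rewrite eqV-refl p | eqV-refl q = refl

  pairSig-comm : ∀ p q x y → pairSig p q x y ≡ pairSig q p x y
  pairSig-comm p q x y = ∨-comm (eqV x p ∧ eqV y q) (eqV x q ∧ eqV y p)

  edgeSig : Edge → Sig n
  edgeSig e = pairSig (tail e) (head e)

  pairSig≐edgeSig : ∀ {a b e} → Joins a b e → pairSig a b ≐ edgeSig e
  pairSig≐edgeSig (inj₁ (refl , refl)) x y = refl
  pairSig≐edgeSig (inj₂ (refl , refl)) x y = pairSig-comm _ _ x y

  sign : Sig n → Edge → Bool
  sign σ e = σ (tail e) (head e)

  sign-edgeSig : ∀ e e′ → sign (edgeSig e) e′ ≡ eqE e′ e
  sign-edgeSig e e′ = ≡-from-true⇔ to (λ t → subst (λ z → sign (edgeSig e) z ≡ true) (sym (eqE-sound e′ e t)) (pairSig-at (tail e) (head e)))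
    where
      to : sign (edgeSig e) e′ ≡ true → eqE e′ e ≡ true
      to t with pairSig-true (tail e) (head e) (tail e′) (head e′) t
      ... | inj₁ (p , q) = subst (λ z → eqE e′ z ≡ true) (ends-injective e′ e p q) (eqE-refl e′)
      ... | inj₂ (p , q) = ⊥-elim (ends-not-crossed e′ e p q)

  matchingSig : Edge → Edge → Sig n
  matchingSig e₁ e₂ x y = edgeSig e₁ x y ∨ edgeSig e₂ x y

  sign-matchingSig : ∀ {e₁ e₂} → e₁ ≢ e₂ → ∀ e → sign (matchingSig e₁ e₂) e ≡ eqE e e₁ xor eqE e e₂
  sign-matchingSig {e₁} {e₂} e₁≢e₂ e = trans (cong₂ _∨_ (sign-edgeSig e₁ e) (sign-edgeSig e₂ e))
    (∨≡xor (eqE e e₁) (eqE e e₂) (∧-false (λ p q → e₁≢e₂ (trans (sym (eqE-sound e e₁ p)) (eqE-sound e e₂ q)))))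

  sign-resign : ∀ (v : V) (σ : Sig n) e → sign (resign v σ) e ≡ sign σ e xor (eqV (tail e) v xor eqV (head e) v)
  sign-resign v σ e rewrite adj-tail-head e = cong (sign σ e xor_) (∨≡xor (eqV (tail e) v) (eqV (head e) v)
    (∧-false (λ p q → tail≢head e (trans (eqV-sound _ v p) (sym (eqV-sound _ v q))))))

  squareParity : Sig n → I → Bool
  squareParity σ k = sign σ (rim outer k) xor (sign σ (rim inner k) xor (sign σ (spoke k) xor sign σ (spoke (next k))))

  outerParity : Sig n → Bool
  outerParity σ = xorSum (λ k → sign σ (rim outer k))

  squareParity-resign : ∀ (v : V) (σ : Sig n) k → squareParity (resign v σ) k ≡ squareParity σ k
  squareParity-resign v σ k = begin
    squareParity (resign v σ) k
      ≡⟨ cong₂ _xor_ (sign-resign v σ (rim outer k)) (cong₂ _xor_ (sign-resign v σ (rim inner k))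
           (cong₂ _xor_ (sign-resign v σ (spoke k)) (sign-resign v σ (spoke (next k))))) ⟩
    (sign σ (rim outer k) xor (a xor b)) xor ((sign σ (rim inner k) xor (c xor d))
      xor ((sign σ (spoke k) xor (a xor c)) xor (sign σ (spoke (next k)) xor (b xor d))))
      ≡⟨ xor-distrib₄ (sign σ (rim outer k)) (sign σ (rim inner k)) (sign σ (spoke k)) (sign σ (spoke (next k))) (a xor b) (c xor d) (a xor c) (b xor d) ⟩
    squareParity σ k xor ((a xor b) xor ((c xor d) xor ((a xor c) xor (b xor d))))
      ≡⟨ cong (squareParity σ k xor_) (xor-4cycle a b c d) ⟩
    squareParity σ k xor false
      ≡⟨ xor-identityʳ _ ⟩
    squareParity σ k ∎
    where
      open ≡-Reasoning
      a b c d : Bool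
      a = eqV (vtx outer k) v
      b = eqV (vtx outer (next k)) v
      c = eqV (vtx inner k) v
      d = eqV (vtx inner (next k)) v

  ⌊next≟⌋ : ∀ i j → ⌊ next i ≟F j ⌋ ≡ ⌊ i ≟F prev j ⌋
  ⌊next≟⌋ i j = ≡-from-true⇔
    (λ e → ⌊⌋-yes (i ≟F prev j) (trans (sym (prev-next i)) (cong prev (⌊⌋-sound (next i ≟F j) e))))
    (λ e → ⌊⌋-yes (next i ≟F j) (trans (cong next (⌊⌋-sound (i ≟F prev j) e)) (next-prev j)))

  outerStar-shift : ∀ (v : V) → xorSum (λ i → eqV (vtx outer (next i)) v) ≡ xorSum (λ i → eqV (vtx outer i) v)
  outerStar-shift (vtx s j) = begin
    xorSum (λ i → c ∧ ⌊ next i ≟F j ⌋)   ≡⟨ xorSum-∧ˡ c (λ i → ⌊ next i ≟F j ⌋) ⟩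
    c ∧ xorSum (λ i → ⌊ next i ≟F j ⌋)   ≡⟨ cong (c ∧_) (trans (xorSum-cong (λ i → ⌊next≟⌋ i j)) (xorSum-indicator (prev j))) ⟩
    c ∧ true                             ≡⟨ cong (c ∧_) (xorSum-indicator j) ⟨
    c ∧ xorSum (λ i → ⌊ i ≟F j ⌋)        ≡⟨ xorSum-∧ˡ c (λ i → ⌊ i ≟F j ⌋) ⟨
    xorSum (λ i → c ∧ ⌊ i ≟F j ⌋)        ∎
    where
      open ≡-Reasoning
      c : Bool
      c = ⌊ outer ≟F s ⌋

  outerParity-resign : ∀ (v : V) (σ : Sig n) → outerParity (resign v σ) ≡ outerParity σ
  outerParity-resign v σ = begin
    outerParity (resign v σ)                         ≡⟨ xorSum-cong (λ i → sign-resign v σ (rim outer i)) ⟩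
    xorSum (λ i → sign σ (rim outer i) xor (a i xor b i)) ≡⟨ xorSum-xor (λ i → sign σ (rim outer i)) (λ i → a i xor b i) ⟩
    outerParity σ xor xorSum (λ i → a i xor b i)     ≡⟨ cong (outerParity σ xor_) (xorSum-xor a b) ⟩
    outerParity σ xor (xorSum a xor xorSum b)        ≡⟨ cong (λ z → outerParity σ xor (xorSum a xor z)) (outerStar-shift v) ⟩
    outerParity σ xor (xorSum a xor xorSum a)        ≡⟨ cong (outerParity σ xor_) (xor-same (xorSum a)) ⟩
    outerParity σ xor false                          ≡⟨ xor-identityʳ _ ⟩
    outerParity σ                                    ∎
    where
      open ≡-Reasoning
      a b : I → Bool
      a i = eqV (vtx outer i) v
      b i = eqV (vtx outer (next i)) v

  squareParity-cong : ∀ {σ τ} → σ ≐ τ → ∀ k → squareParity σ k ≡ squareParity τ k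
  squareParity-cong e k = cong₂ _xor_ (e (vtx outer k) _) (cong₂ _xor_ (e (vtx inner k) _) (cong₂ _xor_ (e (vtx outer k) _) (e (vtx outer (next k)) _)))

  outerParity-cong : ∀ {σ τ} → σ ≐ τ → outerParity σ ≡ outerParity τ
  outerParity-cong e = xorSum-cong (λ i → e (vtx outer i) (vtx outer (next i)))

  squareParity-resignAll : ∀ (vs : List V) (σ : Sig n) k → squareParity (resignAll vs σ) k ≡ squareParity σ k
  squareParity-resignAll []       σ k = refl
  squareParity-resignAll (v ∷ vs) σ k = trans (squareParity-resignAll vs (resign v σ) k) (squareParity-resign v σ k)

  outerParity-resignAll : ∀ (vs : List V) (σ : Sig n) → outerParity (resignAll vs σ) ≡ outerParity σ
  outerParity-resignAll []       σ = refl
  outerParity-resignAll (v ∷ vs) σ = trans (outerParity-resignAll vs (resign v σ)) (outerParity-resign v σ)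

  squareParity-switch : ∀ {σ τ} → SwitchEq σ τ → ∀ k → squareParity σ k ≡ squareParity τ k
  squareParity-switch {σ} (vs , e) k = trans (sym (squareParity-resignAll vs σ k)) (squareParity-cong e k)

  outerParity-switch : ∀ {σ τ} → SwitchEq σ τ → outerParity σ ≡ outerParity τ
  outerParity-switch {σ} (vs , e) = trans (sym (outerParity-resignAll vs σ)) (outerParity-cong e)

  mult₂ : List I → I → Bool
  mult₂ []       k = false
  mult₂ (p ∷ ps) k = ⌊ k ≟F p ⌋ xor mult₂ ps k

  mult₂-++ : ∀ ps qs k → mult₂ (ps ++ qs) k ≡ mult₂ ps k xor mult₂ qs k
  mult₂-++ []       qs k = refl
  mult₂-++ (p ∷ ps) qs k = trans (cong (⌊ k ≟F p ⌋ xor_) (mult₂-++ ps qs k)) (sym (xor-assoc ⌊ k ≟F p ⌋ _ _))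

  mult₂-++-comm : ∀ ps qs k → mult₂ (ps ++ qs) k ≡ mult₂ (qs ++ ps) k
  mult₂-++-comm ps qs k = trans (mult₂-++ ps qs k) (trans (xor-comm (mult₂ ps k) _) (sym (mult₂-++ qs ps k)))

  oddLength : List I → Bool
  oddLength []       = false
  oddLength (_ ∷ ps) = not (oddLength ps)

  xorSum-mult₂ : ∀ ps → xorSum (mult₂ ps) ≡ oddLength ps
  xorSum-mult₂ []       = xorSum-false {N n}
  xorSum-mult₂ (p ∷ ps) = begin
    xorSum (λ k → ⌊ k ≟F p ⌋ xor mult₂ ps k) ≡⟨ xorSum-xor (λ k → ⌊ k ≟F p ⌋) (mult₂ ps) ⟩
    xorSum (λ k → ⌊ k ≟F p ⌋) xor xorSum (mult₂ ps) ≡⟨ cong₂ _xor_ (xorSum-indicator p) (xorSum-mult₂ ps) ⟩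
    not (oddLength ps) ∎
    where open ≡-Reasoning

  -- Square k is bounded by the rims of index k and the spokes k and k + 1.
  squaresOf : Edge → List I
  squaresOf (rim s i) = i ∷ []
  squaresOf (spoke i) = i ∷ prev i ∷ []

  onOuterRim : Edge → Bool
  onOuterRim (rim outer i) = true
  onOuterRim (rim inner i) = false
  onOuterRim (spoke i)     = false

  inSquare : I → Edge → Bool
  inSquare k e = eqE (rim outer k) e xor (eqE (rim inner k) e xor (eqE (spoke k) e xor eqE (spoke (next k)) e))

  inSquare-squaresOf : ∀ k e → inSquare k e ≡ mult₂ (squaresOf e) k
  inSquare-squaresOf k (rim outer i) = refl
  inSquare-squaresOf k (rim inner i) = refl
  inSquare-squaresOf k (spoke i) = cong (⌊ k ≟F i ⌋ xor_) (trans (⌊next≟⌋ k i) (sym (xor-identityʳ _)))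

  squareParity-matchingSig : ∀ {e₁ e₂} → e₁ ≢ e₂ → ∀ k →
    squareParity (matchingSig e₁ e₂) k ≡ mult₂ (squaresOf e₁ ++ squaresOf e₂) k
  squareParity-matchingSig {e₁} {e₂} e₁≢e₂ k = begin
    squareParity (matchingSig e₁ e₂) k
      ≡⟨ cong₂ _xor_ (at (rim outer k)) (cong₂ _xor_ (at (rim inner k)) (cong₂ _xor_ (at (spoke k)) (at (spoke (next k))))) ⟩
    _ ≡⟨ xor-distrib₄ (eqE (rim outer k) e₁) (eqE (rim inner k) e₁) (eqE (spoke k) e₁) (eqE (spoke (next k)) e₁) _ _ _ _ ⟩
    inSquare k e₁ xor inSquare k e₂
      ≡⟨ cong₂ _xor_ (inSquare-squaresOf k e₁) (inSquare-squaresOf k e₂) ⟩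
    mult₂ (squaresOf e₁) k xor mult₂ (squaresOf e₂) k
      ≡⟨ mult₂-++ (squaresOf e₁) (squaresOf e₂) k ⟨
    mult₂ (squaresOf e₁ ++ squaresOf e₂) k ∎
    where
      open ≡-Reasoning
      at : ∀ e → sign (matchingSig e₁ e₂) e ≡ eqE e e₁ xor eqE e e₂
      at = sign-matchingSig e₁≢e₂

  xorSum-onOuterRim : ∀ e → xorSum (λ k → eqE (rim outer k) e) ≡ onOuterRim e
  xorSum-onOuterRim (rim outer i) = xorSum-indicator i
  xorSum-onOuterRim (rim inner i) = xorSum-false {N n}
  xorSum-onOuterRim (spoke i)     = xorSum-false {N n}

  outerParity-matchingSig : ∀ {e₁ e₂} → e₁ ≢ e₂ → outerParity (matchingSig e₁ e₂) ≡ onOuterRim e₁ xor onOuterRim e₂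
  outerParity-matchingSig {e₁} {e₂} e₁≢e₂ = begin
    outerParity (matchingSig e₁ e₂)
      ≡⟨ xorSum-cong (λ k → sign-matchingSig e₁≢e₂ (rim outer k)) ⟩
    xorSum (λ k → eqE (rim outer k) e₁ xor eqE (rim outer k) e₂)
      ≡⟨ xorSum-xor (λ k → eqE (rim outer k) e₁) (λ k → eqE (rim outer k) e₂) ⟩
    xorSum (λ k → eqE (rim outer k) e₁) xor xorSum (λ k → eqE (rim outer k) e₂)
      ≡⟨ cong₂ _xor_ (xorSum-onOuterRim e₁) (xorSum-onOuterRim e₂) ⟩
    onOuterRim e₁ xor onOuterRim e₂ ∎
    where open ≡-Reasoning

  Symmetric : Sig n → Set
  Symmetric σ = ∀ x y → σ x y ≡ σ y x

  OnEdges : Sig n → Set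
  OnEdges σ = ∀ x y → adj x y ≡ false → σ x y ≡ false

  ≐-from-sign : ∀ {σ τ} → Symmetric σ → Symmetric τ → OnEdges σ → OnEdges τ → (∀ e → sign σ e ≡ sign τ e) → σ ≐ τ
  ≐-from-sign sσ sτ oσ oτ signs x y with adj x y in xy
  ... | false = trans (oσ x y xy) (sym (oτ x y xy))
  ... | true with adj⇒edge x y xy
  ...   | e , inj₁ (refl , refl) = signs e
  ...   | e , inj₂ (refl , refl) = trans (sσ _ _) (trans (signs e) (sτ _ _))

  pairSig-symmetric : ∀ p q → Symmetric (pairSig p q)
  pairSig-symmetric p q x y = trans (∨-comm (eqV x p ∧ eqV y q) _) (cong₂ _∨_ (∧-comm (eqV x q) _) (∧-comm (eqV x p) _))

  pairSig-onEdges : ∀ p q → adj p q ≡ true → OnEdges (pairSig p q)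
  pairSig-onEdges p q pq x y xy with pairSig p q x y in t
  ... | false = refl
  ... | true with pairSig-true p q x y t
  ...   | inj₁ (refl , refl) = trans (sym pq) xy
  ...   | inj₂ (refl , refl) = trans (sym pq) (trans (adj-sym p q) xy)

  matchingSig-symmetric : ∀ e₁ e₂ → Symmetric (matchingSig e₁ e₂)
  matchingSig-symmetric e₁ e₂ x y = cong₂ _∨_ (pairSig-symmetric (tail e₁) (head e₁) x y) (pairSig-symmetric (tail e₂) (head e₂) x y)

  matchingSig-onEdges : ∀ e₁ e₂ → OnEdges (matchingSig e₁ e₂)
  matchingSig-onEdges e₁ e₂ x y xy = cong₂ _∨_ (pairSig-onEdges _ _ (adj-tail-head e₁) x y xy) (pairSig-onEdges _ _ (adj-tail-head e₂) x y xy)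

  resignAll-symmetric : ∀ (vs : List V) {σ : Sig n} → Symmetric σ → Symmetric (resignAll vs σ)
  resignAll-symmetric []       sσ = sσ
  resignAll-symmetric (v ∷ vs) sσ = resignAll-symmetric vs (λ x y → cong₂ _xor_ (sσ x y) (cong₂ _∧_ (adj-sym x y) (∨-comm (eqV x v) _)))

  resignAll-onEdges : ∀ (vs : List V) {σ : Sig n} → OnEdges σ → OnEdges (resignAll vs σ)
  resignAll-onEdges []       oσ = oσ
  resignAll-onEdges (v ∷ vs) {σ} oσ = resignAll-onEdges vs λ x y xy → begin
    σ x y xor (adj x y ∧ (eqV x v ∨ eqV y v)) ≡⟨ cong (λ b → σ x y xor (b ∧ (eqV x v ∨ eqV y v))) xy ⟩
    σ x y xor false                          ≡⟨ xor-identityʳ (σ x y) ⟩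
    σ x y                                    ≡⟨ oσ x y xy ⟩
    false                                    ∎
    where open ≡-Reasoning

  resignAll-≐ : ∀ (vs : List V) {σ τ : Sig n} → σ ≐ τ → resignAll vs σ ≐ resignAll vs τ
  resignAll-≐ []       e = e
  resignAll-≐ (v ∷ vs) e = resignAll-≐ vs (λ x y → cong (_xor (adj x y ∧ (eqV x v ∨ eqV y v))) (e x y))

  _∈ends_ : V → Edge → Set
  x ∈ends e = x ≡ tail e ⊎ x ≡ head e

  Disjoint : Edge → Edge → Set
  Disjoint e₁ e₂ = ∀ {x} → x ∈ends e₁ → x ∈ends e₂ → ⊥

  Disjoint-sym : ∀ {e₁ e₂} → Disjoint e₁ e₂ → Disjoint e₂ e₁
  Disjoint-sym D p q = D q p

  Disjoint⇒≢ : ∀ {e₁ e₂} → Disjoint e₁ e₂ → e₁ ≢ e₂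
  Disjoint⇒≢ D refl = D (inj₁ refl) (inj₁ refl)

  Joins-ends : ∀ {a b e x} → Joins a b e → x ∈ends e → x ≡ a ⊎ x ≡ b
  Joins-ends (inj₁ (refl , refl)) p = p
  Joins-ends (inj₂ (refl , refl)) (inj₁ p) = inj₂ p
  Joins-ends (inj₂ (refl , refl)) (inj₂ p) = inj₁ p

  Matching2⇒Disjoint : ∀ (M : Matching2 n) {e₁ e₂} → let open Matching2 M in
    Joins a b e₁ → Joins c d e₂ → Disjoint e₁ e₂
  Matching2⇒Disjoint M J₁ J₂ p q with Joins-ends J₁ p | Joins-ends J₂ q
  ... | inj₁ refl | inj₁ x≡c = Matching2.a≢c M x≡c
  ... | inj₁ refl | inj₂ x≡d = Matching2.a≢d M x≡d
  ... | inj₂ refl | inj₁ x≡c = Matching2.b≢c M x≡c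
  ... | inj₂ refl | inj₂ x≡d = Matching2.b≢d M x≡d

  sigOf≐matchingSig : ∀ (M : Matching2 n) {e₁ e₂} → let open Matching2 M in
    Joins a b e₁ → Joins c d e₂ → sigOf M ≐ matchingSig e₁ e₂
  sigOf≐matchingSig M J₁ J₂ x y = trans (sym (∨-assoc (eqV x a ∧ eqV y b) (eqV x b ∧ eqV y a) _))
    (cong₂ _∨_ (pairSig≐edgeSig J₁ x y) (pairSig≐edgeSig J₂ x y))
    where open Matching2 M

  matching : ∀ {e₁ e₂} → Disjoint e₁ e₂ → Matching2 n
  matching {e₁} {e₂} D = record
    { a = tail e₁ ; b = head e₁ ; c = tail e₂ ; d = head e₂
    ; ab-edge = adj-tail-head e₁ ; cd-edge = adj-tail-head e₂
    ; a≢c = λ p → D (inj₁ refl) (inj₁ p) ; a≢d = λ p → D (inj₁ refl) (inj₂ p)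
    ; b≢c = λ p → D (inj₂ refl) (inj₁ p) ; b≢d = λ p → D (inj₂ refl) (inj₂ p) }

  sigOf-matching : ∀ {e₁ e₂} (D : Disjoint e₁ e₂) → sigOf (matching D) ≐ matchingSig e₁ e₂
  sigOf-matching D = sigOf≐matchingSig (matching D) (inj₁ (refl , refl)) (inj₁ (refl , refl))

  module _ (ψ : Aut n) where

    toᴬ-fromᴬ : ∀ x → toᴬ ψ (fromᴬ ψ x) ≡ x
    toᴬ-fromᴬ x = Inverse.inverseˡ (proj₁ ψ) refl

    fromᴬ-toᴬ : ∀ x → fromᴬ ψ (toᴬ ψ x) ≡ x
    fromᴬ-toᴬ x = Inverse.inverseʳ (proj₁ ψ) refl

    toᴬ-injective : ∀ {x y} → toᴬ ψ x ≡ toᴬ ψ y → x ≡ y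
    toᴬ-injective {x} {y} e = trans (sym (fromᴬ-toᴬ x)) (trans (cong (fromᴬ ψ) e) (fromᴬ-toᴬ y))

    toᴬ-adj : ∀ x y → adj x y ≡ true → adj (toᴬ ψ x) (toᴬ ψ y) ≡ true
    toᴬ-adj x y e = trans (proj₂ ψ x y) e

    eqV-fromᴬ : ∀ x a → eqV (fromᴬ ψ x) a ≡ eqV x (toᴬ ψ a)
    eqV-fromᴬ x a = ≡-from-true⇔
      (λ e → subst (λ z → eqV z (toᴬ ψ a) ≡ true) (trans (cong (toᴬ ψ) (sym (eqV-sound _ a e))) (toᴬ-fromᴬ x)) (eqV-refl (toᴬ ψ a)))
      (λ e → subst (λ z → eqV z a ≡ true) (trans (sym (fromᴬ-toᴬ a)) (cong (fromᴬ ψ) (sym (eqV-sound x _ e)))) (eqV-refl a))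

    applyAut-pairSig : ∀ p q → applyAut ψ (pairSig p q) ≐ pairSig (toᴬ ψ p) (toᴬ ψ q)
    applyAut-pairSig p q x y rewrite eqV-fromᴬ x p | eqV-fromᴬ x q | eqV-fromᴬ y p | eqV-fromᴬ y q = refl

    MapsEdges : (Edge → Edge) → Set
    MapsEdges im = ∀ e → Joins (toᴬ ψ (tail e)) (toᴬ ψ (head e)) (im e)

    applyAut-matchingSig : ∀ {im} → MapsEdges im → ∀ e₁ e₂ → applyAut ψ (matchingSig e₁ e₂) ≐ matchingSig (im e₁) (im e₂)
    applyAut-matchingSig ok e₁ e₂ x y = cong₂ _∨_
      (trans (applyAut-pairSig (tail e₁) (head e₁) x y) (pairSig≐edgeSig (ok e₁) x y))
      (trans (applyAut-pairSig (tail e₂) (head e₂) x y) (pairSig≐edgeSig (ok e₂) x y))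

    image-ends : ∀ {im} → MapsEdges im → ∀ {e x} → x ∈ends im e → Σ V λ y → y ∈ends e × x ≡ toᴬ ψ y
    image-ends ok {e} p with Joins-ends (ok e) p
    ... | inj₁ q = tail e , inj₁ refl , q
    ... | inj₂ q = head e , inj₂ refl , q

    Disjoint-image : ∀ {im} → MapsEdges im → ∀ {e₁ e₂} → Disjoint e₁ e₂ → Disjoint (im e₁) (im e₂)
    Disjoint-image ok D p q with image-ends ok p | image-ends ok q
    ... | y₁ , p₁ , refl | y₂ , p₂ , e = D p₁ (subst (_∈ends _) (sym (toᴬ-injective e)) p₂)

  record Invariants (e₁ e₂ t₁ t₂ : Edge) : Set where
    field
      oddSquares : ∀ k → mult₂ (squaresOf e₁ ++ squaresOf e₂) k ≡ mult₂ (squaresOf t₁ ++ squaresOf t₂) k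
      outerRims  : onOuterRim e₁ xor onOuterRim e₂ ≡ onOuterRim t₁ xor onOuterRim t₂

  invariants : ∀ {σ τ e₁ e₂ t₁ t₂} → e₁ ≢ e₂ → t₁ ≢ t₂ → σ ≐ matchingSig e₁ e₂ → τ ≐ matchingSig t₁ t₂ →
    SwitchEq σ τ → Invariants e₁ e₂ t₁ t₂
  invariants {σ} {τ} {e₁} {e₂} {t₁} {t₂} e₁≢e₂ t₁≢t₂ σ≐ τ≐ sw = record
    { oddSquares = λ k → begin
        mult₂ (squaresOf e₁ ++ squaresOf e₂) k ≡⟨ squareParity-matchingSig e₁≢e₂ k ⟨
        squareParity (matchingSig e₁ e₂) k     ≡⟨ squareParity-cong σ≐ k ⟨
        squareParity σ k                       ≡⟨ squareParity-switch sw k ⟩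
        squareParity τ k                       ≡⟨ squareParity-cong τ≐ k ⟩
        squareParity (matchingSig t₁ t₂) k     ≡⟨ squareParity-matchingSig t₁≢t₂ k ⟩
        mult₂ (squaresOf t₁ ++ squaresOf t₂) k ∎
    ; outerRims = begin
        onOuterRim e₁ xor onOuterRim e₂   ≡⟨ outerParity-matchingSig e₁≢e₂ ⟨
        outerParity (matchingSig e₁ e₂)   ≡⟨ outerParity-cong σ≐ ⟨
        outerParity σ                     ≡⟨ outerParity-switch sw ⟩
        outerParity τ                     ≡⟨ outerParity-cong τ≐ ⟩
        outerParity (matchingSig t₁ t₂)   ≡⟨ outerParity-matchingSig t₁≢t₂ ⟩
        onOuterRim t₁ xor onOuterRim t₂   ∎ }
    where open ≡-Reasoning

  oddLengths : ∀ {e₁ e₂ t₁ t₂} → Invariants e₁ e₂ t₁ t₂ → oddLength (squaresOf e₁ ++ squaresOf e₂) ≡ oddLength (squaresOf t₁ ++ squaresOf t₂)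
  oddLengths {e₁} {e₂} {t₁} {t₂} V = trans (sym (xorSum-mult₂ (squaresOf e₁ ++ squaresOf e₂)))
    (trans (xorSum-cong (Invariants.oddSquares V)) (xorSum-mult₂ (squaresOf t₁ ++ squaresOf t₂)))

  -- Automorphisms are dihedral

  rim-4cycle : ∀ w x y → adj w x ≡ true → adj (rimNext w) y ≡ true → adj x y ≡ true → x ≢ rimNext w → y ≢ w → x ≡ spokeMate w
  rim-4cycle w x y wx w⁺y xy x≢w⁺ y≢w with adj⇒neighbour w x wx
  ... | inj₁ x≡w′ = x≡w′
  ... | inj₂ (inj₁ x≡w⁺) = ⊥-elim (x≢w⁺ x≡w⁺)
  rim-4cycle (vtx s i) x y wx w⁺y xy x≢w⁺ y≢w | inj₂ (inj₂ refl) with adj⇒neighbour (vtx s (next i)) y w⁺y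
  ... | inj₂ (inj₂ refl) = ⊥-elim (y≢w (cong (vtx s) (prev-next i)))
  ... | inj₁ refl with adj⇒neighbour (vtx s (prev i)) (vtx (other s) (next i)) xy
  ...   | inj₁ e        = ⊥-elim (next-≢-prev 2≤2n i (cong Vtx.idx e))
  ...   | inj₂ (inj₁ e) = ⊥-elim (other-≢ s (sym (cong Vtx.side e)))
  ...   | inj₂ (inj₂ e) = ⊥-elim (other-≢ s (sym (cong Vtx.side e)))
  rim-4cycle (vtx s i) x y wx w⁺y xy x≢w⁺ y≢w | inj₂ (inj₂ refl) | inj₂ (inj₁ refl)
    with adj⇒neighbour (vtx s (prev i)) (vtx s (next (next i))) xy
  ...   | inj₁ e        = ⊥-elim (other-≢ s (cong Vtx.side e))
  ...   | inj₂ (inj₁ e) = ⊥-elim (next²-≢ 2≤2n i (trans (cong Vtx.idx e) (next-prev i)))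
  ...   | inj₂ (inj₂ e) = ⊥-elim (next²-≢-prev² i (cong Vtx.idx e))

  rimNext-rimPrev : ∀ x → rimNext (rimPrev x) ≡ x
  rimNext-rimPrev x = cong (vtx (Vtx.side x)) (next-prev (Vtx.idx x))

  module Rigidity (ψ : Aut n) where

    private
      f : V → V
      f = toᴬ ψ

    sameRim-image : ∀ x z → adj x z ≡ true → Vtx.side z ≡ Vtx.side x → f (spokeMate x) ≡ rimNext (f x) → f z ≡ spokeMate (f x)
    sameRim-image x z xz same e = rim-4cycle (f x) (f z) (f (spokeMate z))
      (toᴬ-adj ψ x z xz)
      (subst (λ w → adj w (f (spokeMate z)) ≡ true) e (toᴬ-adj ψ (spokeMate x) (spokeMate z) (trans (proj₂ swapᴬ x z) xz)))
      (toᴬ-adj ψ z (spokeMate z) (adj-spokeMate z))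
      (λ p → other-≢ (Vtx.side x) (trans (sym same) (cong Vtx.side (toᴬ-injective ψ (trans p (sym e))))))
      (λ p → other-≢ (Vtx.side x) (sym (trans (cong other (sym same)) (cong Vtx.side (toᴬ-injective ψ p)))))

    -- A spoke cannot go to a rim edge: the two squares through the spoke would map to one square.
    spoke↛rimNext : ∀ x → f (spokeMate x) ≢ rimNext (f x)
    spoke↛rimNext x e = next-≢-prev 2≤2n (Vtx.idx x) (cong Vtx.idx (toᴬ-injective ψ
      (trans (sameRim-image x (rimNext x) (adj-rimNext x) refl e) (sym (sameRim-image x (rimPrev x) (adj-rimPrev x) refl e)))))

    toᴬ-spokeMate : ∀ x → f (spokeMate x) ≡ spokeMate (f x)
    toᴬ-spokeMate x with adj⇒neighbour (f x) (f (spokeMate x)) (toᴬ-adj ψ x (spokeMate x) (adj-spokeMate x))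
    ... | inj₁ e        = e
    ... | inj₂ (inj₁ e) = ⊥-elim (spoke↛rimNext x e)
    ... | inj₂ (inj₂ e) = ⊥-elim (spoke↛rimNext (spokeMate x)
                            (trans (cong f (spokeMate-involutive x)) (trans (sym (rimNext-rimPrev (f x))) (cong rimNext (sym e)))))

    toᴬ-rimNext : ∀ x → f (rimNext x) ≡ rimNext (f x) ⊎ f (rimNext x) ≡ rimPrev (f x)
    toᴬ-rimNext x with adj⇒neighbour (f x) (f (rimNext x)) (toᴬ-adj ψ x (rimNext x) (adj-rimNext x))
    ... | inj₁ e = ⊥-elim (other-≢ (Vtx.side x) (cong Vtx.side (toᴬ-injective ψ (trans e (sym (toᴬ-spokeMate x))))))
    ... | inj₂ r = r

    side₀ : Fin 2
    side₀ = Vtx.side (f (vtx outer fzero))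

    h : I → I
    h i = Vtx.idx (f (vtx outer i))

    side-residue : ∀ t → Vtx.side (f (vtx outer (residue t))) ≡ side₀
    side-residue zero = refl
    side-residue (suc t) with toᴬ-rimNext (vtx outer (residue t))
    ... | inj₁ e = trans (cong Vtx.side e) (side-residue t)
    ... | inj₂ e = trans (cong Vtx.side e) (side-residue t)

    side-outer : ∀ i → Vtx.side (f (vtx outer i)) ≡ side₀
    side-outer i = subst (λ j → Vtx.side (f (vtx outer j)) ≡ side₀) (residue-toℕ i) (side-residue (toℕ i))

    sideMap : Fin 2 → Fin 2
    sideMap outer = side₀
    sideMap inner = other side₀

    toᴬ-vtx : ∀ s i → f (vtx s i) ≡ vtx (sideMap s) (h i)
    toᴬ-vtx outer i = cong (λ s → vtx s (h i)) (side-outer i)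
    toᴬ-vtx inner i = trans (toᴬ-spokeMate (vtx outer i)) (cong (λ s → vtx (other s) (h i)) (side-outer i))

    h-injective : ∀ {i j} → h i ≡ h j → i ≡ j
    h-injective {i} {j} e = cong Vtx.idx (toᴬ-injective ψ (trans (toᴬ-vtx outer i) (trans (cong (vtx side₀) e) (sym (toᴬ-vtx outer j)))))

    h-next : ∀ i → h (next i) ≡ next (h i) ⊎ h (next i) ≡ prev (h i)
    h-next i with toᴬ-rimNext (vtx outer i)
    ... | inj₁ e = inj₁ (cong Vtx.idx e)
    ... | inj₂ e = inj₂ (cong Vtx.idx e)

    Increasing Decreasing : Set
    Increasing = ∀ i → h (next i) ≡ next (h i)
    Decreasing = ∀ i → h (next i) ≡ prev (h i)

    -- Once h steps forward (backward) at i, it must do so at i + 1 as well, or h would repeat a value.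
    orientation : Increasing ⊎ Decreasing
    orientation with h-next fzero
    ... | inj₁ e = inj₁ (λ i → subst (λ j → h (next j) ≡ next (h j)) (residue-toℕ i) (forward e (toℕ i)))
      where
        forward : h (next fzero) ≡ next (h fzero) → ∀ t → h (next (residue t)) ≡ next (h (residue t))
        forward e zero = e
        forward e (suc t) with h-next (next (residue t))
        ... | inj₁ e′ = e′
        ... | inj₂ e′ = ⊥-elim (next²-≢ 2≤2n (residue t) (h-injective (trans e′ (trans (cong prev (forward e t)) (prev-next _)))))
    ... | inj₂ e = inj₂ (λ i → subst (λ j → h (next j) ≡ prev (h j)) (residue-toℕ i) (backward e (toℕ i)))
      where
        backward : h (next fzero) ≡ prev (h fzero) → ∀ t → h (next (residue t)) ≡ prev (h (residue t))
        backward e zero = e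
        backward e (suc t) with h-next (next (residue t))
        ... | inj₂ e′ = e′
        ... | inj₁ e′ = ⊥-elim (next²-≢ 2≤2n (residue t) (h-injective (trans e′ (trans (cong next (backward e t)) (next-prev _)))))

    h-increasing : Increasing → ∀ t → h (residue t) ≡ rotate t (h fzero)
    h-increasing inc zero    = refl
    h-increasing inc (suc t) = trans (inc (residue t)) (cong next (h-increasing inc t))

    h-decreasing : Decreasing → ∀ t → rotate t (h (residue t)) ≡ h fzero
    h-decreasing dec zero    = refl
    h-decreasing dec (suc t) = begin
      next (rotate t (h (next (residue t))))  ≡⟨ cong (next ∘ rotate t) (dec (residue t)) ⟩
      next (rotate t (prev (h (residue t))))  ≡⟨ rotate-comm 1 t _ ⟩
      rotate t (next (prev (h (residue t))))  ≡⟨ cong (rotate t) (next-prev _) ⟩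
      rotate t (h (residue t))                ≡⟨ h-decreasing dec t ⟩
      h fzero                                 ∎
      where open ≡-Reasoning

    spokeJoins : ∀ s i → Joins (vtx s i) (vtx (other s) i) (spoke i)
    spokeJoins outer i = inj₁ (refl , refl)
    spokeJoins inner i = inj₂ (refl , refl)

    spoke-image : ∀ i → Joins (f (vtx outer i)) (f (vtx inner i)) (spoke (h i))
    spoke-image i = subst₂ (λ a b → Joins a b (spoke (h i))) (sym (toᴬ-vtx outer i)) (sym (toᴬ-vtx inner i)) (spokeJoins side₀ (h i))

    -- A decreasing ψ reverses the direction of the rims, so the rim edge at i goes to the one at h i − 1.
    image : (I → I) → Edge → Edge
    image r (rim s i) = rim (sideMap s) (r i)
    image r (spoke i) = spoke (h i)

    image-increasing : Increasing → MapsEdges ψ (image h)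
    image-increasing inc (rim s i) = inj₁ (toᴬ-vtx s i , trans (toᴬ-vtx s (next i)) (cong (vtx (sideMap s)) (inc i)))
    image-increasing inc (spoke i) = spoke-image i

    image-decreasing : Decreasing → MapsEdges ψ (image (prev ∘ h))
    image-decreasing dec (rim s i) = inj₂ (trans (toᴬ-vtx s i) (cong (vtx (sideMap s)) (sym (next-prev (h i))))
                                        , trans (toᴬ-vtx s (next i)) (cong (vtx (sideMap s)) (dec i)))
    image-decreasing dec (spoke i) = spoke-image i

-- Normal forms

data Kind : Set where
  oppositeRims spokeAndRim sameRim twoSpokes : Kind

record Class : Set where
  constructor _at_
  field
    kind : Kind
    gap  : ℕ

module Index (n : ℕ) (2≤n : 2 ≤ n) where

  Valid : Class → Set
  Valid (oppositeRims at δ) = δ ≤ n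
  Valid (spokeAndRim at δ)  = 1 ≤ δ × δ ≤ n
  Valid (sameRim at δ)      = 2 ≤ δ × δ ≤ n
  Valid (twoSpokes at δ)    = 2 ≤ δ × δ ≤ n

  decode : ℕ → Class
  decode k with k ≤? n
  ... | yes _ = oppositeRims at k
  ... | no _ with k ≤? 2 * n
  ...   | yes _ = spokeAndRim at (k ∸ n)
  ...   | no _ with k <? 3 * n
  ...     | yes _ = sameRim at suc (k ∸ 2 * n)
  ...     | no _  = twoSpokes at suc (suc (k ∸ 3 * n))

  encode : Class → ℕ
  encode (oppositeRims at δ) = δ
  encode (spokeAndRim at δ)  = n + δ
  encode (sameRim at δ)      = 2 * n + (δ ∸ 1)
  encode (twoSpokes at δ)    = 3 * n + (δ ∸ 2)

  encode-decode : ∀ k → encode (decode k) ≡ k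
  encode-decode k with k ≤? n
  ... | yes _ = refl
  ... | no k≰n with k ≤? 2 * n
  ...   | yes _ = m+[n∸m]≡n (<⇒≤ (≰⇒> k≰n))
  ...   | no k≰2n with k <? 3 * n
  ...     | yes _ = m+[n∸m]≡n (<⇒≤ (≰⇒> k≰2n))
  ...     | no k≮3n = m+[n∸m]≡n (≮⇒≥ k≮3n)

  1≤n : 1 ≤ n
  1≤n = ≤-trans (s≤s z≤n) 2≤n

  2n≡n+n : 2 * n ≡ n + n
  2n≡n+n = cong (n +_) (+-identityʳ n)

  3n≡2n+n : 3 * n ≡ 2 * n + n
  3n≡2n+n = +-comm n (2 * n)

  4n≡3n+n : 4 * n ≡ 3 * n + n
  4n≡3n+n = +-comm n (3 * n)

  n<2n : n < 2 * n
  n<2n = subst (n <_) (sym 2n≡n+n) (m<m+n n 1≤n)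

  <4n∸1 : ∀ {x} → suc (suc x) ≤ 4 * n → x < 4 * n ∸ 1
  <4n∸1 {x} le = m+n≤o⇒m≤o∸n (suc x) (subst (_≤ 4 * n) (+-comm 1 (suc x)) le)

  decode-valid : ∀ k → k < 4 * n ∸ 1 → Valid (decode k)
  decode-valid k lt with k ≤? n
  ... | yes k≤n = k≤n
  ... | no k≰n with k ≤? 2 * n
  ...   | yes k≤2n = m<n⇒0<n∸m (≰⇒> k≰n) , subst (k ∸ n ≤_) (trans (cong (_∸ n) 2n≡n+n) (m+n∸m≡n n n)) (∸-monoˡ-≤ n k≤2n)
  ...   | no k≰2n with k <? 3 * n
  ...     | yes k<3n = s≤s (m<n⇒0<n∸m (≰⇒> k≰2n)) , subst (k ∸ 2 * n <_) (trans (cong (_∸ 2 * n) 3n≡2n+n) (m+n∸m≡n (2 * n) n)) (∸-monoˡ-< k<3n (<⇒≤ (≰⇒> k≰2n)))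
  ...     | no k≮3n = s≤s (s≤s z≤n) , +-cancelʳ-≤ (3 * n) _ _ (subst₂ _≤_ (cong (λ z → suc (suc z)) (sym (m∸n+n≡m (≮⇒≥ k≮3n)))) (trans 4n≡3n+n (+-comm (3 * n) n)) k+2≤4n)
    where
      k+2≤4n : suc (suc k) ≤ 4 * n
      k+2≤4n = subst (_≤ 4 * n) (+-comm (suc k) 1) (m≤o∸n⇒m+n≤o (suc k) (≤-trans 1≤n (≤-trans (m≤m+n n _) ≤-refl)) lt)

  decode-encode : ∀ c → Valid c → decode (encode c) ≡ c
  decode-encode (oppositeRims at δ) v with δ ≤? n
  ... | yes _ = refl
  ... | no δ≰n = ⊥-elim (δ≰n v)
  decode-encode (spokeAndRim at δ) (1≤δ , δ≤n) with n + δ ≤? n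
  ... | yes le = ⊥-elim (<⇒≱ (m<m+n n 1≤δ) le)
  ... | no _ with n + δ ≤? 2 * n
  ...   | yes _ = cong (spokeAndRim at_) (m+n∸m≡n n δ)
  ...   | no ne = ⊥-elim (ne (subst (n + δ ≤_) (sym 2n≡n+n) (+-monoʳ-≤ n δ≤n)))
  decode-encode (sameRim at suc δ) (s≤s 1≤δ , δ≤n) with 2 * n + δ ≤? n
  ... | yes le = ⊥-elim (<⇒≱ (≤-trans n<2n (m≤m+n (2 * n) δ)) le)
  ... | no _ with 2 * n + δ ≤? 2 * n
  ...   | yes le = ⊥-elim (<⇒≱ (m<m+n (2 * n) 1≤δ) le)
  ...   | no _ with 2 * n + δ <? 3 * n
  ...     | yes _ = cong (λ z → sameRim at suc z) (m+n∸m≡n (2 * n) δ)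
  ...     | no ne = ⊥-elim (ne (subst (2 * n + δ <_) (sym 3n≡2n+n) (+-monoʳ-< (2 * n) δ≤n)))
  decode-encode (twoSpokes at suc (suc δ)) (s≤s (s≤s _) , δ≤n) with 3 * n + δ ≤? n
  ... | yes le = ⊥-elim (<⇒≱ (≤-trans (subst (n <_) (sym 3n≡2n+n) (m<n+m n (≤-trans 1≤n (m≤m+n n _)))) (m≤m+n (3 * n) δ)) le)
  ... | no _ with 3 * n + δ ≤? 2 * n
  ...   | yes le = ⊥-elim (<⇒≱ (≤-trans (subst (2 * n <_) (sym 3n≡2n+n) (m<m+n (2 * n) 1≤n)) (m≤m+n (3 * n) δ)) le)
  ...   | no _ with 3 * n + δ <? 3 * n
  ...     | yes lt = ⊥-elim (<⇒≱ lt (m≤m+n (3 * n) δ))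
  ...     | no _ = cong (λ z → twoSpokes at suc (suc z)) (m+n∸m≡n (3 * n) δ)

  encode-bound : ∀ c → Valid c → encode c < 4 * n ∸ 1
  encode-bound (oppositeRims at δ) δ≤n = <4n∸1 (≤-trans (+-mono-≤ 2≤n δ≤n) (+-monoʳ-≤ n (m≤m+n n _)))
  encode-bound (spokeAndRim at δ) (_ , δ≤n) = <4n∸1 (+-mono-≤ 2≤n (+-monoʳ-≤ n (≤-trans δ≤n (m≤m+n n _))))
  encode-bound (sameRim at suc δ) (_ , δ<n) =
    <4n∸1 (+-mono-≤ 2≤n (subst (2 * n + δ ≤_) (sym 3n≡2n+n) (+-monoʳ-≤ (2 * n) (≤-trans (n≤1+n δ) δ<n))))
  encode-bound (twoSpokes at suc (suc δ)) (s≤s (s≤s _) , δ≤n) =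
    <4n∸1 (subst₂ _≤_ (lemma (3 * n) δ) (sym 4n≡3n+n) (+-monoʳ-≤ (3 * n) δ≤n))
    where lemma : ∀ a b → a + (2 + b) ≡ 2 + (a + b)
          lemma a b = trans (+-suc a (suc b)) (cong suc (+-suc a b))

module Classification (n : ℕ) (2≤n : 2 ≤ n) where

  open Index n 2≤n public
  open Edges n 1≤n public

  edgesOf : Class → Edge × Edge
  edgesOf (oppositeRims at δ) = rim outer fzero , rim inner (residue δ)
  edgesOf (spokeAndRim at δ)  = spoke fzero     , rim outer (residue δ)
  edgesOf (sameRim at δ)      = rim outer fzero , rim outer (residue δ)
  edgesOf (twoSpokes at δ)    = spoke fzero     , spoke (residue δ)

  classSig : Class → Sig n
  classSig c = matchingSig (proj₁ (edgesOf c)) (proj₂ (edgesOf c))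

  ≤n⇒<N : ∀ {δ} → δ ≤ n → δ < N n
  ≤n⇒<N δ≤n = s≤s (≤-trans δ≤n (m≤m+n n (n + 0)))

  ≤n⇒suc<N : ∀ {δ} → δ ≤ n → suc δ < N n
  ≤n⇒suc<N δ≤n = s≤s (≤-trans (s≤s δ≤n) (subst (_≤ 2 * n) (+-comm n 1) (+-monoʳ-≤ n (≤-trans 1≤n (m≤m+n n 0)))))

  vtx-residue-≢ : ∀ {s t} → s < N n → t < N n → s ≢ t → ∀ {side side′} → vtx {n} side (residue s) ≢ vtx side′ (residue t)
  vtx-residue-≢ s< t< s≢t e = s≢t (residue-injective s< t< (cong Vtx.idx e))

  edgesOf-disjoint : ∀ c → Valid c → Disjoint (proj₁ (edgesOf c)) (proj₂ (edgesOf c))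
  edgesOf-disjoint (oppositeRims at δ) _ (inj₁ refl) (inj₁ ())
  edgesOf-disjoint (oppositeRims at δ) _ (inj₁ refl) (inj₂ ())
  edgesOf-disjoint (oppositeRims at δ) _ (inj₂ refl) (inj₁ ())
  edgesOf-disjoint (oppositeRims at δ) _ (inj₂ refl) (inj₂ ())
  edgesOf-disjoint (spokeAndRim at suc δ) (s≤s _ , δ<n) (inj₁ refl) (inj₁ e) = vtx-residue-≢ (s≤s z≤n) (≤n⇒<N δ<n) (λ ()) e
  edgesOf-disjoint (spokeAndRim at suc δ) (s≤s _ , δ<n) (inj₁ refl) (inj₂ e) = vtx-residue-≢ (s≤s z≤n) (≤n⇒suc<N δ<n) (λ ()) e
  edgesOf-disjoint (spokeAndRim at δ) _ (inj₂ refl) (inj₁ ())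
  edgesOf-disjoint (spokeAndRim at δ) _ (inj₂ refl) (inj₂ ())
  edgesOf-disjoint (sameRim at suc (suc δ)) (s≤s (s≤s _) , δ<n) (inj₁ refl) (inj₁ e) = vtx-residue-≢ (s≤s z≤n) (≤n⇒<N δ<n) (λ ()) e
  edgesOf-disjoint (sameRim at suc (suc δ)) (s≤s (s≤s _) , δ<n) (inj₁ refl) (inj₂ e) = vtx-residue-≢ (s≤s z≤n) (≤n⇒suc<N δ<n) (λ ()) e
  edgesOf-disjoint (sameRim at suc (suc δ)) (s≤s (s≤s _) , δ<n) (inj₂ refl) (inj₁ e) = vtx-residue-≢ (≤n⇒suc<N z≤n) (≤n⇒<N δ<n) (λ ()) e
  edgesOf-disjoint (sameRim at suc (suc δ)) (s≤s (s≤s _) , δ<n) (inj₂ refl) (inj₂ e) = vtx-residue-≢ (≤n⇒suc<N z≤n) (≤n⇒suc<N δ<n) (λ ()) e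
  edgesOf-disjoint (twoSpokes at suc zero) (s≤s () , _) _ _
  edgesOf-disjoint (twoSpokes at suc (suc δ)) (s≤s (s≤s _) , δ<n) (inj₁ refl) (inj₁ e) = vtx-residue-≢ (s≤s z≤n) (≤n⇒<N δ<n) (λ ()) e
  edgesOf-disjoint (twoSpokes at δ) _ (inj₁ refl) (inj₂ ())
  edgesOf-disjoint (twoSpokes at δ) _ (inj₂ refl) (inj₁ ())
  edgesOf-disjoint (twoSpokes at suc (suc δ)) (s≤s (s≤s _) , δ<n) (inj₂ refl) (inj₂ e) = vtx-residue-≢ (s≤s z≤n) (≤n⇒<N δ<n) (λ ()) e

  representative : (c : Class) → Valid c → Matching2 n
  representative c v = matching (edgesOf-disjoint c v)

  -- Every 2-matching has a normal form

  record IsoToMatching (σ : Sig n) (e₁ e₂ : Edge) : Set where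
    constructor isoToMatching
    field
      aut      : Aut n
      carries  : applyAut aut σ ≐ matchingSig e₁ e₂
      disjoint : Disjoint e₁ e₂

  carry : ∀ {σ e₁ e₂} (φ : Aut n) {im} → MapsEdges φ im → IsoToMatching σ e₁ e₂ → IsoToMatching σ (im e₁) (im e₂)
  carry φ ok (isoToMatching ψ c D) = isoToMatching (φ ∘ᴬ ψ)
    (λ x y → trans (c (fromᴬ φ x) (fromᴬ φ y)) (applyAut-matchingSig φ ok _ _ x y)) (Disjoint-image φ ok D)

  exchange : ∀ {σ e₁ e₂} → IsoToMatching σ e₁ e₂ → IsoToMatching σ e₂ e₁
  exchange {e₁ = e₁} {e₂} (isoToMatching ψ c D) = isoToMatching ψ (λ x y → trans (c x y) (∨-comm (edgeSig e₁ x y) (edgeSig e₂ x y))) (Disjoint-sym D)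

  rotateᴱ : ℕ → Edge → Edge
  rotateᴱ t (rim s i) = rim s (rotate t i)
  rotateᴱ t (spoke i) = spoke (rotate t i)

  rotateᴱ-maps : ∀ t → MapsEdges (rotateᴬ t) (rotateᴱ t)
  rotateᴱ-maps t (rim s i) = inj₁ (refl , cong (vtx s) (rotate-comm t 1 i))
  rotateᴱ-maps t (spoke i) = inj₁ (refl , refl)

  swapᴱ : Edge → Edge
  swapᴱ (rim s i) = rim (other s) i
  swapᴱ (spoke i) = spoke i

  swapᴱ-maps : MapsEdges swapᴬ swapᴱ
  swapᴱ-maps (rim s i) = inj₁ (refl , refl)
  swapᴱ-maps (spoke i) = inj₂ (refl , refl)

  reflectᴱ : Edge → Edge
  reflectᴱ (rim s i) = rim s (prev (reflect i))
  reflectᴱ (spoke i) = spoke (reflect i)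

  reflectᴱ-maps : MapsEdges reflectᴬ reflectᴱ
  reflectᴱ-maps (rim s i) = inj₂ (cong (vtx s) (sym (next-prev (reflect i))) , cong (vtx s) (reflect-next i))
  reflectᴱ-maps (spoke i) = inj₁ (refl , refl)

  toOrigin : I → ℕ
  toOrigin i = 2 * n * toℕ i

  Offset : I → I → ℕ → Set
  Offset i j δ = rotate (toOrigin i) j ≡ residue δ

  offset : ∀ i j → Σ ℕ λ δ → δ < N n × Offset i j δ
  offset i j = toℕ (rotate (toOrigin i) j) , toℕ<n _ , sym (residue-toℕ _)

  offset-rotate : ∀ {i j} δ → Offset i j δ → j ≡ rotate δ i
  offset-rotate {i} {j} δ o = begin
    j                                      ≡⟨ rotate-inverseʳ (toℕ i) j ⟨
    rotate (toℕ i) (rotate (toOrigin i) j)  ≡⟨ cong (rotate (toℕ i)) o ⟩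
    rotate (toℕ i) (rotate δ fzero)         ≡⟨ rotate-comm (toℕ i) δ fzero ⟩
    rotate δ (residue (toℕ i))             ≡⟨ cong (rotate δ) (residue-toℕ i) ⟩
    rotate δ i                             ∎
    where open ≡-Reasoning

  -- Of the two offsets i → j and j → i, which sum to 2n + 1, one is at most n.
  offset-≤n : ∀ i j → (Σ ℕ λ δ → δ ≤ n × Offset i j δ) ⊎ (Σ ℕ λ δ → δ ≤ n × Offset j i δ)
  offset-≤n i j with offset i j
  ... | δ , δ<N , o with δ ≤? n
  ...   | yes δ≤n = inj₁ (δ , δ≤n , o)
  ...   | no δ≰n  = inj₂ (N n ∸ δ , N∸δ≤n , (begin
    rotate (toOrigin j) i                                ≡⟨ cong (rotate (toOrigin j)) i≡ ⟩
    rotate (toOrigin j) (rotate (N n ∸ δ) j)             ≡⟨ rotate-comm (toOrigin j) (N n ∸ δ) j ⟩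
    rotate (N n ∸ δ) (rotate (toOrigin j) j)             ≡⟨ cong (rotate (N n ∸ δ)) (rotate-toℕ j) ⟩
    residue (N n ∸ δ)                                    ∎))
    where
      open ≡-Reasoning
      N∸δ≤n : N n ∸ δ ≤ n
      N∸δ≤n = ≤-trans (∸-monoʳ-≤ (N n) (≰⇒> δ≰n)) (≤-reflexive (trans (m+n∸m≡n n (n + 0)) (+-identityʳ n)))
      i≡ : i ≡ rotate (N n ∸ δ) j
      i≡ = sym (begin
        rotate (N n ∸ δ) j                 ≡⟨ cong (rotate (N n ∸ δ)) (offset-rotate δ o) ⟩
        rotate (N n ∸ δ) (rotate δ i)      ≡⟨ rotate-+ (N n ∸ δ) δ i ⟩
        rotate (N n ∸ δ + δ) i             ≡⟨ rotate-cong (N n ∸ δ + δ) 0 i (trans (cong (_% N n) (m∸n+n≡m (<⇒≤ δ<N))) ([m+n]%n≡m%n 0 (N n))) ⟩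
        i                                  ∎)

  residue-≢ : ∀ {s t} → s < N n → t < N n → s ≢ t → residue s ≢ residue t
  residue-≢ s< t< s≢t e = s≢t (residue-injective s< t< e)

  1<N : 1 < N n
  1<N = ≤n⇒<N 1≤n

  2<N : 2 < N n
  2<N = ≤n⇒<N 2≤n

  -- Resigning at u₁ and u₂ turns the spokes u₁v₁, u₂v₂ into the rim edges u₀u₁, u₂u₃.
  adjacentSpokes≐rims : resignAll (vtx outer (residue 1) ∷ vtx outer (residue 2) ∷ []) (matchingSig (spoke (residue 1)) (spoke (residue 2)))
                        ≐ classSig (sameRim at 2)
  adjacentSpokes≐rims = ≐-from-sign
    (resignAll-symmetric us (matchingSig-symmetric (spoke (residue 1)) (spoke (residue 2))))
    (matchingSig-symmetric (rim outer fzero) (rim outer (residue 2)))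
    (resignAll-onEdges us (matchingSig-onEdges (spoke (residue 1)) (spoke (residue 2))))
    (matchingSig-onEdges (rim outer fzero) (rim outer (residue 2))) signs
    where
      us : List V
      us = vtx outer (residue 1) ∷ vtx outer (residue 2) ∷ []
      spokes≢ : spoke (residue 1) ≢ spoke (residue 2)
      spokes≢ e = residue-≢ 1<N 2<N (λ ()) (cong (λ { (spoke i) → i ; (rim _ i) → i }) e)
      rims≢ : rim outer fzero ≢ rim outer (residue 2)
      rims≢ e = residue-≢ (s≤s z≤n) 2<N (λ ()) (cong (λ { (spoke i) → i ; (rim _ i) → i }) e)
      cancel : ∀ a b c → (a xor b) xor (c xor a) ≡ b xor c
      cancel a b c = trans (solve 3 (λ a b c → (a :+ b) :+ (c :+ a) := (a :+ a) :+ (b :+ c)) refl a b c)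
                           (cong (_xor (b xor c)) (xor-same a))
      cancel′ : ∀ a c → ((a xor c) xor (a xor false)) xor (c xor false) ≡ false
      cancel′ false false = refl
      cancel′ false true  = refl
      cancel′ true  false = refl
      cancel′ true  true  = refl
      signs : ∀ e → sign (resignAll (vtx outer (residue 1) ∷ vtx outer (residue 2) ∷ []) (matchingSig (spoke (residue 1)) (spoke (residue 2)))) e
                    ≡ sign (classSig (sameRim at 2)) e
      signs e rewrite sign-resign (vtx outer (residue 2)) (resign (vtx outer (residue 1)) (matchingSig (spoke (residue 1)) (spoke (residue 2)))) e
                    | sign-resign (vtx outer (residue 1)) (matchingSig (spoke (residue 1)) (spoke (residue 2))) e
                    | sign-matchingSig spokes≢ e | sign-matchingSig rims≢ e with e
      ... | rim outer i rewrite ⌊next≟⌋ i (residue 1) | ⌊next≟⌋ i (residue 2) | prev-next fzero | prev-next (residue 1)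
        = cancel ⌊ i ≟F residue 1 ⌋ ⌊ i ≟F fzero ⌋ ⌊ i ≟F residue 2 ⌋
      ... | rim inner i = refl
      ... | spoke i = cancel′ ⌊ i ≟F residue 1 ⌋ ⌊ i ≟F residue 2 ⌋

  Classified : Sig n → Set
  Classified σ = Σ Class λ c → Valid c × SwitchIso σ (classSig c)

  classified : ∀ {σ} c → Valid c → IsoToMatching σ (proj₁ (edgesOf c)) (proj₂ (edgesOf c)) → Classified σ
  classified c v (isoToMatching ψ carries _) = c , v , ψ , [] , carries

  retarget : ∀ {σ e₁ e₂ e₁′ e₂′} → e₁ ≡ e₁′ → e₂ ≡ e₂′ → IsoToMatching σ e₁ e₂ → IsoToMatching σ e₁′ e₂′
  retarget refl refl q = q

  classify-outerRim : ∀ {σ} s δ → δ ≤ n → IsoToMatching σ (rim outer fzero) (rim s (residue δ)) → Classified σ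
  classify-outerRim inner δ δ≤n q = classified (oppositeRims at δ) δ≤n q
  classify-outerRim outer zero _ q = ⊥-elim (IsoToMatching.disjoint q (inj₁ refl) (inj₁ refl))
  classify-outerRim outer (suc zero) _ q = ⊥-elim (IsoToMatching.disjoint q (inj₂ refl) (inj₁ refl))
  classify-outerRim outer (suc (suc δ)) δ≤n q = classified (sameRim at suc (suc δ)) (s≤s (s≤s z≤n) , δ≤n) q

  classify-rims : ∀ {σ} s s′ δ → δ ≤ n → IsoToMatching σ (rim s fzero) (rim s′ (residue δ)) → Classified σ
  classify-rims outer s′ δ δ≤n q = classify-outerRim s′ δ δ≤n q
  classify-rims inner s′ δ δ≤n q = classify-outerRim (other s′) δ δ≤n (carry swapᴬ swapᴱ-maps q)

  classify-spokeOuterRim : ∀ {σ} δ → δ ≤ n → IsoToMatching σ (spoke fzero) (rim outer (residue δ)) → Classified σ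
  classify-spokeOuterRim zero _ q = ⊥-elim (IsoToMatching.disjoint q (inj₁ refl) (inj₁ refl))
  classify-spokeOuterRim (suc δ) δ≤n q = classified (spokeAndRim at suc δ) (s≤s z≤n , δ≤n) q

  classify-spokeRim : ∀ {σ} s δ → δ ≤ n → IsoToMatching σ (spoke fzero) (rim s (residue δ)) → Classified σ
  classify-spokeRim outer δ δ≤n q = classify-spokeOuterRim δ δ≤n q
  classify-spokeRim inner δ δ≤n q = classify-spokeOuterRim δ δ≤n (carry swapᴬ swapᴱ-maps q)

  classify-spokes : ∀ {σ} δ → δ ≤ n → IsoToMatching σ (spoke fzero) (spoke (residue δ)) → Classified σ
  classify-spokes zero _ q = ⊥-elim (IsoToMatching.disjoint q (inj₁ refl) (inj₁ refl))
  classify-spokes (suc zero) _ q with carry (rotateᴬ 1) (rotateᴱ-maps 1) q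
  ... | isoToMatching ψ carries _ = sameRim at 2 , (≤-refl , 2≤n) , ψ , us ,
    λ x y → trans (resignAll-≐ us carries x y) (adjacentSpokes≐rims x y)
    where us = vtx outer (residue 1) ∷ vtx outer (residue 2) ∷ []
  classify-spokes (suc (suc δ)) δ≤n q = classified (twoSpokes at suc (suc δ)) (s≤s (s≤s z≤n) , δ≤n) q

  recentre : ∀ {σ e₁ e₂} i → IsoToMatching σ e₁ e₂ → IsoToMatching σ (rotateᴱ (toOrigin i) e₁) (rotateᴱ (toOrigin i) e₂)
  recentre i = carry (rotateᴬ (toOrigin i)) (rotateᴱ-maps (toOrigin i))

  2n∸δ≤n : ∀ {δ} → n < δ → 2 * n ∸ δ ≤ n
  2n∸δ≤n n<δ = ≤-trans (∸-monoʳ-≤ (2 * n) (<⇒≤ n<δ)) (≤-reflexive (trans (m+n∸m≡n n (n + 0)) (+-identityʳ n)))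

  classify-spokeRim-far : ∀ {σ} s δ → δ < N n → IsoToMatching σ (spoke fzero) (rim s (residue δ)) → Classified σ
  classify-spokeRim-far s δ δ<N q with δ ≤? n
  ... | yes δ≤n = classify-spokeRim s δ δ≤n q
  ... | no δ≰n  = classify-spokeRim s (2 * n ∸ δ) (2n∸δ≤n (≰⇒> δ≰n))
    (retarget (cong spoke reflect-zero) (cong (rim s) (prev-reflect-residue δ (≤-pred δ<N))) (carry reflectᴬ reflectᴱ-maps q))

  classify-edges : ∀ {σ} e₁ e₂ → IsoToMatching σ e₁ e₂ → Classified σ
  classify-edges (rim s i) (rim s′ j) q with offset-≤n i j
  ... | inj₁ (δ , δ≤n , o) = classify-rims s s′ δ δ≤n (retarget (cong (rim s) (rotate-toℕ i)) (cong (rim s′) o) (recentre i q))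
  ... | inj₂ (δ , δ≤n , o) = classify-rims s′ s δ δ≤n (retarget (cong (rim s′) (rotate-toℕ j)) (cong (rim s) o) (recentre j (exchange q)))
  classify-edges (rim s i) (spoke j) q with offset j i
  ... | δ , δ<N , o = classify-spokeRim-far s δ δ<N (retarget (cong spoke (rotate-toℕ j)) (cong (rim s) o) (recentre j (exchange q)))
  classify-edges (spoke i) (rim s j) q with offset i j
  ... | δ , δ<N , o = classify-spokeRim-far s δ δ<N (retarget (cong spoke (rotate-toℕ i)) (cong (rim s) o) (recentre i q))
  classify-edges (spoke i) (spoke j) q with offset-≤n i j
  ... | inj₁ (δ , δ≤n , o) = classify-spokes δ δ≤n (retarget (cong spoke (rotate-toℕ i)) (cong spoke o) (recentre i q))
  ... | inj₂ (δ , δ≤n , o) = classify-spokes δ δ≤n (retarget (cong spoke (rotate-toℕ j)) (cong spoke o) (recentre j (exchange q)))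

  classify : ∀ (M : Matching2 n) → Classified (sigOf M)
  classify M with adj⇒edge a b ab-edge | adj⇒edge c d cd-edge
    where open Matching2 M
  ... | e₁ , J₁ | e₂ , J₂ = classify-edges e₁ e₂ (isoToMatching idᴬ (sigOf≐matchingSig M J₁ J₂) (Matching2⇒Disjoint M J₁ J₂))

  -- Distinct normal forms are not switching isomorphic

  mult₂-sound : ∀ ps k → mult₂ ps k ≡ true → k ∈ ps
  mult₂-sound (p ∷ ps) k e with k ≟F p
  ... | yes k≡p = here k≡p
  ... | no _    = there (mult₂-sound ps k e)

  mult₂-∉ : ∀ ps k → k ∉ ps → mult₂ ps k ≡ false
  mult₂-∉ ps k k∉ps with mult₂ ps k in e
  ... | false = refl
  ... | true  = ⊥-elim (k∉ps (mult₂-sound ps k e))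

  mult₂-complete : ∀ {ps k} → Unique ps → k ∈ ps → mult₂ ps k ≡ true
  mult₂-complete {p ∷ ps} {k} (p∉ps ∷ᵖ u) (here refl) rewrite mult₂-∉ ps k (All¬⇒¬Any p∉ps) = cong (_xor false) (⌊⌋-yes (k ≟F k) refl)
  mult₂-complete {p ∷ ps} {k} (p∉ps ∷ᵖ u) (there k∈ps) = trans (cong (_xor mult₂ ps k) (⌊⌋-no (k ≟F p) k≢p)) (mult₂-complete u k∈ps)
    where k≢p : k ≢ p
          k≢p refl = All¬⇒¬Any p∉ps k∈ps

  ∈-transfer : ∀ {ps qs} → (∀ k → mult₂ ps k ≡ mult₂ qs k) → Unique ps → ∀ {k} → k ∈ ps → k ∈ qs
  ∈-transfer {ps} {qs} same u {k} k∈ps = mult₂-sound qs k (trans (sym (same k)) (mult₂-complete u k∈ps))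

  0<N : 0 < N n
  0<N = s≤s z≤n

  2n<N : 2 * n < N n
  2n<N = ≤-refl

  1≢2n : 1 ≢ 2 * n
  1≢2n = <⇒≢ 2≤2n

  f≢t : false ≢ true
  f≢t ()

  three-in-pair : ∀ (x y z p q : I) → x ≢ y → x ≢ z → y ≢ z → x ∈ (p ∷ q ∷ []) → y ∈ (p ∷ q ∷ []) → z ∈ (p ∷ q ∷ []) → ⊥
  three-in-pair x y z p q xy xz yz (here refl) (here refl) _ = xy refl
  three-in-pair x y z p q xy xz yz (here refl) (there (here refl)) (here refl) = xz refl
  three-in-pair x y z p q xy xz yz (here refl) (there (here refl)) (there (here refl)) = yz refl
  three-in-pair x y z p q xy xz yz (there (here refl)) (here refl) (here refl) = yz refl
  three-in-pair x y z p q xy xz yz (there (here refl)) (here refl) (there (here refl)) = xz refl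
  three-in-pair x y z p q xy xz yz (there (here refl)) (there (here refl)) _ = xy refl
  three-in-pair x y z p q xy xz yz _ _ (there (there ()))
  three-in-pair x y z p q xy xz yz _ (there (there ())) _
  three-in-pair x y z p q xy xz yz (there (there ())) _ _

  <N⇒≢+N : ∀ {a b} → a < N n → a ≢ b + N n
  <N⇒≢+N {a} {b} lt e = <⇒≱ lt (subst (N n ≤_) (sym e) (m≤n+m (N n) b))

  +<N : ∀ {a b} → a ≤ n → b ≤ n → a + b < N n
  +<N {a} {b} a≤ b≤ = s≤s (subst (a + b ≤_) (sym 2n≡n+n) (+-mono-≤ a≤ b≤))

  +<2N : ∀ {a b} → a < N n → b < N n → a + b < N n + N n
  +<2N a< b< = +-mono-≤ a< (<⇒≤ b<)

  ≤n⇒suc<2n : ∀ {d} → d ≤ n → suc d < 2 * n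
  ≤n⇒suc<2n {d} le = subst (suc (suc d) ≤_) (sym 2n≡n+n) (+-mono-≤ 2≤n le)

  <N⇒<2N : ∀ {a} → a < N n → a < N n + N n
  <N⇒<2N a< = ≤-trans a< (m≤m+n (N n) (N n))

  residue-cases : ∀ {R : Set} a b → a < N n + N n → b < N n → residue a ≡ residue b → (a ≡ b → R) → (a ≡ b + N n → R) → R
  residue-cases a b a< b< e k1 k2 with residue-≡ a b a< b< e
  ... | inj₁ p = k1 p
  ... | inj₂ p = k2 p

  unique₂ : ∀ {x y : I} → x ≢ y → Unique (x ∷ y ∷ [])
  unique₂ x≢y = (x≢y ∷ᵃ []ᵃ) ∷ᵖ []ᵃ ∷ᵖ []ᵖ

  unique₃ : ∀ {x y z : I} → x ≢ y → x ≢ z → y ≢ z → Unique (x ∷ y ∷ z ∷ [])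
  unique₃ x≢y x≢z y≢z = (x≢y ∷ᵃ x≢z ∷ᵃ []ᵃ) ∷ᵖ unique₂ y≢z

  unique₄ : ∀ {x y z w : I} → x ≢ y → x ≢ z → x ≢ w → y ≢ z → y ≢ w → z ≢ w → Unique (x ∷ y ∷ z ∷ w ∷ [])
  unique₄ x≢y x≢z x≢w y≢z y≢w z≢w = (x≢y ∷ᵃ x≢z ∷ᵃ x≢w ∷ᵃ []ᵃ) ∷ᵖ unique₃ y≢z y≢w z≢w

  -- In the gap lemmas below, the first list is the image of one normal form's odd squares, written around
  -- a base point B, and the second is another normal form's. Each proof places B and its translates in the
  -- second list; every placement except the intended one violates 1 ≤ d ≤ n < 2n + 1.
  pair-gap-unique : ∀ B d₁ d₂ → 1 ≤ d₁ → d₁ ≤ n → 1 ≤ d₂ → d₂ ≤ n → (∀ k → mult₂ (B ∷ rotate d₁ B ∷ []) k ≡ mult₂ (fzero ∷ residue d₂ ∷ []) k) → d₁ ≡ d₂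
  pair-gap-unique B d₁ d₂ 1≤d₁ d₁≤ 1≤d₂ d₂≤ H = go (tr (here refl)) (tr (there (here refl)))
    where
      unique : Unique (B ∷ rotate d₁ B ∷ [])
      unique = unique₂ (rotate-≢ B 0<N (≤n⇒<N d₁≤) (<⇒≢ 1≤d₁))
      tr : ∀ {k} → k ∈ (B ∷ rotate d₁ B ∷ []) → k ∈ (fzero ∷ residue d₂ ∷ [])
      tr = ∈-transfer H unique
      d₁< : d₁ < N n
      d₁< = ≤n⇒<N d₁≤
      d₂< : d₂ < N n
      d₂< = ≤n⇒<N d₂≤
      go : ∀ {B'} → B' ∈ (fzero ∷ residue d₂ ∷ []) → (rotate d₁ B') ∈ (fzero ∷ residue d₂ ∷ []) → d₁ ≡ d₂
      go (here refl) (here e) = residue-cases d₁ 0 (<N⇒<2N d₁<) 0<N e (λ p → ⊥-elim (m<n⇒n≢0 1≤d₁ p)) (λ p → ⊥-elim (<N⇒≢+N {b = 0} d₁< p))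
      go (here refl) (there (here e)) = residue-cases d₁ d₂ (<N⇒<2N d₁<) d₂< e (λ p → p) (λ p → ⊥-elim (<N⇒≢+N d₁< p))
      go (there (here refl)) (here e) = residue-cases (d₁ + d₂) 0 (+<2N d₁< d₂<) 0<N (trans (sym (rotate-residue d₁ d₂)) e)
         (λ p → ⊥-elim (m<n⇒n≢0 1≤d₁ (m+n≡0⇒m≡0 d₁ p))) (λ p → ⊥-elim (<N⇒≢+N {b = 0} (+<N d₁≤ d₂≤) p))
      go (there (here refl)) (there (here e)) = residue-cases (d₁ + d₂) d₂ (+<2N d₁< d₂<) d₂< (trans (sym (rotate-residue d₁ d₂)) e)
         (λ p → ⊥-elim (m<n⇒n≢0 1≤d₁ (+-cancelʳ-≡ d₂ d₁ 0 p))) (λ p → ⊥-elim (<N⇒≢+N (+<N d₁≤ d₂≤) p))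
      go (there (there ())) _
      go _ (there (there ()))

  ≤n⇒<2n : ∀ {d} → d ≤ n → d < 2 * n
  ≤n⇒<2n le = ≤-trans (n≤1+n _) (≤n⇒suc<2n le)

  +≡2n⇒≡ : ∀ {a b} → a ≤ n → b ≤ n → a + b ≡ 2 * n → a ≡ b
  +≡2n⇒≡ {a} {b} a≤ b≤ e = trans (pa a≤ b≤ e) (sym (pa b≤ a≤ (trans (+-comm b a) e)))
    where
      pa : ∀ {a b} → a ≤ n → b ≤ n → a + b ≡ 2 * n → a ≡ n
      pa {a} {b} a≤ b≤ e with a <? n
      ... | yes lt = ⊥-elim (<⇒≢ (subst (a + b <_) (sym 2n≡n+n) (+-mono-<-≤ lt b≤)) e)
      ... | no nlt = ≤-antisym a≤ (≮⇒≥ nlt)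

  +2n≡+N⇒≡suc : ∀ a c → a + 2 * n ≡ c + N n → a ≡ suc c
  +2n≡+N⇒≡suc a c e = +-cancelʳ-≡ (2 * n) a (suc c) (trans e (+-suc c (2 * n)))

  +2n≢≤n : ∀ {a d} → d ≤ n → a + 2 * n ≢ d
  +2n≢≤n {a} {d} le e = <⇒≢ (≤-trans (≤n⇒<2n le) (m≤n+m (2 * n) a)) (sym e)

  spokeRim-gapᴵ : ∀ B d₁ d₂ → 1 ≤ d₁ → d₁ ≤ n → 1 ≤ d₂ → d₂ ≤ n
    → (∀ k → mult₂ (rotate 1 B ∷ B ∷ rotate (suc d₁) B ∷ []) k ≡ mult₂ (fzero ∷ residue (2 * n) ∷ residue d₂ ∷ []) k) → d₁ ≡ d₂
  spokeRim-gapᴵ B d₁ d₂ 1≤d₁ d₁≤ 1≤d₂ d₂≤ H = go (tr (there (here refl))) (tr (here refl)) (tr (there (there (here refl))))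
    where
      d₁< : d₁ < N n
      d₁< = ≤n⇒<N d₁≤
      d₂< : d₂ < N n
      d₂< = ≤n⇒<N d₂≤
      sd₁< : suc d₁ < N n
      sd₁< = ≤n⇒suc<N d₁≤
      sd₂< : suc d₂ < N n
      sd₂< = ≤n⇒suc<N d₂≤
      unique : Unique (rotate 1 B ∷ B ∷ rotate (suc d₁) B ∷ [])
      unique = unique₃ (rotate-≢ B 1<N 0<N (λ ())) (rotate-≢ B 1<N sd₁< (λ e → m<n⇒n≢0 1≤d₁ (sym (cong pred e))))
               (rotate-≢ B 0<N sd₁< (λ ()))
      LT : List I
      LT = fzero ∷ residue (2 * n) ∷ residue d₂ ∷ []
      tr : ∀ {k} → k ∈ (rotate 1 B ∷ B ∷ rotate (suc d₁) B ∷ []) → k ∈ LT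
      tr = ∈-transfer H unique
      go : ∀ {B'} → B' ∈ LT → (rotate 1 B') ∈ LT → (rotate (suc d₁) B') ∈ LT → d₁ ≡ d₂
      go (here refl) (here e) _ = residue-cases 1 0 (<N⇒<2N 1<N) 0<N e (λ ()) (λ p → ⊥-elim (<N⇒≢+N {b = 0} 1<N p))
      go (here refl) (there (here e)) _ = residue-cases 1 (2 * n) (<N⇒<2N 1<N) 2n<N e (λ p → ⊥-elim (1≢2n p)) (λ p → ⊥-elim (<N⇒≢+N 1<N p))
      go (here refl) (there (there (here e))) mD = residue-cases 1 d₂ (<N⇒<2N 1<N) d₂< e (λ p → go1 p mD) (λ p → ⊥-elim (<N⇒≢+N 1<N p))
        where
          go1 : 1 ≡ d₂ → (rotate (suc d₁) fzero) ∈ LT → d₁ ≡ d₂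
          go1 p (here e') = residue-cases (suc d₁) 0 (<N⇒<2N sd₁<) 0<N e' (λ ()) (λ q → ⊥-elim (<N⇒≢+N {b = 0} sd₁< q))
          go1 p (there (here e')) = residue-cases (suc d₁) (2 * n) (<N⇒<2N sd₁<) 2n<N e' (λ q → ⊥-elim (<⇒≢ (≤n⇒suc<2n d₁≤) q)) (λ q → ⊥-elim (<N⇒≢+N sd₁< q))
          go1 p (there (there (here e'))) = residue-cases (suc d₁) d₂ (<N⇒<2N sd₁<) d₂< e' (λ q → ⊥-elim (m<n⇒n≢0 1≤d₁ (cong pred (trans q (sym p))))) (λ q → ⊥-elim (<N⇒≢+N sd₁< q))
          go1 p (there (there (there ())))
      go (here refl) (there (there (there ()))) _
      go (there (here refl)) _ (here e) = residue-cases (suc d₁ + 2 * n) 0 (+<2N sd₁< 2n<N) 0<N (trans (sym (rotate-residue (suc d₁) (2 * n))) e)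
           (λ ()) (λ p → ⊥-elim (m<n⇒n≢0 1≤d₁ (+-cancelʳ-≡ (2 * n) d₁ 0 (suc-injective p))))
      go (there (here refl)) _ (there (here e)) = residue-cases (suc d₁ + 2 * n) (2 * n) (+<2N sd₁< 2n<N) 2n<N (trans (sym (rotate-residue (suc d₁) (2 * n))) e)
           (λ p → ⊥-elim (0≢1+n (sym (+-cancelʳ-≡ (2 * n) (suc d₁) 0 p)))) (λ p → ⊥-elim (<⇒≢ sd₁< (+-cancelʳ-≡ (2 * n) (suc d₁) (N n) (trans p (+-comm (2 * n) (N n))))))
      go (there (here refl)) _ (there (there (here e))) = residue-cases (suc d₁ + 2 * n) d₂ (+<2N sd₁< 2n<N) d₂< (trans (sym (rotate-residue (suc d₁) (2 * n))) e)
           (λ p → ⊥-elim (+2n≢≤n {a = suc d₁} d₂≤ p)) (λ p → +-cancelʳ-≡ (2 * n) d₁ d₂ (suc-injective (trans p (+-suc d₂ (2 * n)))))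
      go (there (here refl)) _ (there (there (there ())))
      go (there (there (here refl))) (here e) _ = residue-cases (suc d₂) 0 (<N⇒<2N sd₂<) 0<N e (λ ()) (λ p → ⊥-elim (<N⇒≢+N {b = 0} sd₂< p))
      go (there (there (here refl))) (there (here e)) _ = residue-cases (suc d₂) (2 * n) (<N⇒<2N sd₂<) 2n<N e (λ p → ⊥-elim (<⇒≢ (≤n⇒suc<2n d₂≤) p)) (λ p → ⊥-elim (<N⇒≢+N sd₂< p))
      go (there (there (here refl))) (there (there (here e))) _ = residue-cases (suc d₂) d₂ (<N⇒<2N sd₂<) d₂< e (λ p → ⊥-elim (<⇒≢ (n<1+n d₂) (sym p))) (λ p → ⊥-elim (<N⇒≢+N sd₂< p))
      go (there (there (here refl))) (there (there (there ()))) _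
      go (there (there (there ()))) _ _

  ≤n⇒2+<N : ∀ {d} → d ≤ n → suc (suc d) < N n
  ≤n⇒2+<N le = s≤s (≤n⇒suc<2n le)

  spokeRim-gapᴰ : ∀ B d₁ d₂ → 1 ≤ d₁ → d₁ ≤ n → 1 ≤ d₂ → d₂ ≤ n
    → (∀ k → mult₂ (rotate (suc d₁) B ∷ rotate d₁ B ∷ B ∷ []) k ≡ mult₂ (fzero ∷ residue (2 * n) ∷ residue d₂ ∷ []) k) → d₁ ≡ d₂
  spokeRim-gapᴰ B d₁ d₂ 1≤d₁ d₁≤ 1≤d₂ d₂≤ H = go (tr (there (there (here refl)))) (tr (there (here refl))) (tr (here refl))
    where
      d₁< : d₁ < N n
      d₁< = ≤n⇒<N d₁≤
      d₂< : d₂ < N n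
      d₂< = ≤n⇒<N d₂≤
      sd₁< : suc d₁ < N n
      sd₁< = ≤n⇒suc<N d₁≤
      unique : Unique (rotate (suc d₁) B ∷ rotate d₁ B ∷ B ∷ [])
      unique = unique₃ (rotate-≢ B sd₁< d₁< (λ e → <⇒≢ (n<1+n d₁) (sym e))) (rotate-≢ B sd₁< 0<N (λ ())) (rotate-≢ B d₁< 0<N (m<n⇒n≢0 1≤d₁))
      LT : List I
      LT = fzero ∷ residue (2 * n) ∷ residue d₂ ∷ []
      tr : ∀ {k} → k ∈ (rotate (suc d₁) B ∷ rotate d₁ B ∷ B ∷ []) → k ∈ LT
      tr = ∈-transfer H unique
      go : ∀ {B'} → B' ∈ LT → (rotate d₁ B') ∈ LT → (rotate (suc d₁) B') ∈ LT → d₁ ≡ d₂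
      go (here refl) (here e) _ = residue-cases d₁ 0 (<N⇒<2N d₁<) 0<N e (λ p → ⊥-elim (m<n⇒n≢0 1≤d₁ p)) (λ p → ⊥-elim (<N⇒≢+N {b = 0} d₁< p))
      go (here refl) (there (here e)) _ = residue-cases d₁ (2 * n) (<N⇒<2N d₁<) 2n<N e (λ p → ⊥-elim (<⇒≢ (≤n⇒<2n d₁≤) p)) (λ p → ⊥-elim (<N⇒≢+N d₁< p))
      go (here refl) (there (there (here e))) _ = residue-cases d₁ d₂ (<N⇒<2N d₁<) d₂< e (λ p → p) (λ p → ⊥-elim (<N⇒≢+N d₁< p))
      go (here refl) (there (there (there ()))) _
      go (there (here refl)) (here e) mD2 = residue-cases (d₁ + 2 * n) 0 (+<2N d₁< 2n<N) 0<N (trans (sym (rotate-residue d₁ (2 * n))) e)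
           (λ p → ⊥-elim (m<n⇒n≢0 1≤d₁ (m+n≡0⇒m≡0 d₁ p))) (λ p → go2 (+-cancelʳ-≡ (2 * n) d₁ 1 p) mD2)
        where
          go2 : d₁ ≡ 1 → (rotate (suc d₁) (residue (2 * n))) ∈ LT → d₁ ≡ d₂
          go2 p (here e') = residue-cases (2 + 2 * n) 0 (+<2N (2<N) 2n<N) 0<N (subst (λ z → residue (suc z + 2 * n) ≡ fzero) p (trans (sym (rotate-residue (suc d₁) (2 * n))) e'))
            (λ ()) (λ q → ⊥-elim (<⇒≢ (n<1+n _) (sym (suc-injective q))))
          go2 p (there (here e')) = residue-cases (2 + 2 * n) (2 * n) (+<2N (2<N) 2n<N) 2n<N (subst (λ z → residue (suc z + 2 * n) ≡ residue (2 * n)) p (trans (sym (rotate-residue (suc d₁) (2 * n))) e'))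
            (λ q → ⊥-elim (0≢1+n (sym (+-cancelʳ-≡ (2 * n) 2 0 q)))) (λ q → ⊥-elim (<⇒≢ (2<N) (+-cancelʳ-≡ (2 * n) 2 (N n) (trans q (+-comm (2 * n) (N n))))))
          go2 p (there (there (here e'))) = residue-cases (2 + 2 * n) d₂ (+<2N (2<N) 2n<N) d₂< (subst (λ z → residue (suc z + 2 * n) ≡ residue d₂) p (trans (sym (rotate-residue (suc d₁) (2 * n))) e'))
            (λ q → ⊥-elim (+2n≢≤n {a = 2} d₂≤ q)) (λ q → trans p (suc-injective (+2n≡+N⇒≡suc 2 d₂ q)))
          go2 p (there (there (there ())))
      go (there (here refl)) (there (here e)) _ = residue-cases (d₁ + 2 * n) (2 * n) (+<2N d₁< 2n<N) 2n<N (trans (sym (rotate-residue d₁ (2 * n))) e)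
           (λ p → ⊥-elim (m<n⇒n≢0 1≤d₁ (+-cancelʳ-≡ (2 * n) d₁ 0 p))) (λ p → ⊥-elim (<⇒≢ d₁< (+-cancelʳ-≡ (2 * n) d₁ (N n) (trans p (+-comm (2 * n) (N n))))))
      go (there (here refl)) (there (there (here e))) mD2 = residue-cases (d₁ + 2 * n) d₂ (+<2N d₁< 2n<N) d₂< (trans (sym (rotate-residue d₁ (2 * n))) e)
           (λ p → ⊥-elim (+2n≢≤n {a = d₁} d₂≤ p)) (λ p → go3 (+2n≡+N⇒≡suc d₁ d₂ p) mD2)
        where
          v< : suc (suc d₂) + 2 * n < N n + N n
          v< = +<2N (≤n⇒2+<N d₂≤) 2n<N
          go3 : d₁ ≡ suc d₂ → (rotate (suc d₁) (residue (2 * n))) ∈ LT → d₁ ≡ d₂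
          go3 q (here e') = residue-cases (suc (suc d₂) + 2 * n) 0 v< 0<N (subst (λ z → residue (suc z + 2 * n) ≡ fzero) q (trans (sym (rotate-residue (suc d₁) (2 * n))) e'))
            (λ ()) (λ r → ⊥-elim (0≢1+n (sym (+-cancelʳ-≡ (2 * n) (suc d₂) 0 (suc-injective r)))))
          go3 q (there (here e')) = residue-cases (suc (suc d₂) + 2 * n) (2 * n) v< 2n<N (subst (λ z → residue (suc z + 2 * n) ≡ residue (2 * n)) q (trans (sym (rotate-residue (suc d₁) (2 * n))) e'))
            (λ r → ⊥-elim (0≢1+n (sym (+-cancelʳ-≡ (2 * n) (suc (suc d₂)) 0 r)))) (λ r → ⊥-elim (<⇒≢ (≤n⇒2+<N d₂≤) (+-cancelʳ-≡ (2 * n) (suc (suc d₂)) (N n) (trans r (+-comm (2 * n) (N n))))))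
          go3 q (there (there (here e'))) = residue-cases (suc (suc d₂) + 2 * n) d₂ v< d₂< (subst (λ z → residue (suc z + 2 * n) ≡ residue d₂) q (trans (sym (rotate-residue (suc d₁) (2 * n))) e'))
            (λ r → ⊥-elim (+2n≢≤n {a = suc (suc d₂)} d₂≤ r)) (λ r → ⊥-elim (<⇒≢ (n<1+n (suc d₂)) (sym (+2n≡+N⇒≡suc (suc (suc d₂)) d₂ r))))
          go3 q (there (there (there ())))
      go (there (here refl)) (there (there (there ()))) _
      go (there (there (here refl))) (here e) _ = residue-cases (d₁ + d₂) 0 (+<2N d₁< d₂<) 0<N (trans (sym (rotate-residue d₁ d₂)) e)
           (λ p → ⊥-elim (m<n⇒n≢0 1≤d₁ (m+n≡0⇒m≡0 d₁ p))) (λ p → ⊥-elim (<N⇒≢+N {b = 0} (+<N d₁≤ d₂≤) p))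
      go (there (there (here refl))) (there (here e)) _ = residue-cases (d₁ + d₂) (2 * n) (+<2N d₁< d₂<) 2n<N (trans (sym (rotate-residue d₁ d₂)) e)
           (λ p → +≡2n⇒≡ d₁≤ d₂≤ p) (λ p → ⊥-elim (<N⇒≢+N (+<N d₁≤ d₂≤) p))
      go (there (there (here refl))) (there (there (here e))) _ = residue-cases (d₁ + d₂) d₂ (+<2N d₁< d₂<) d₂< (trans (sym (rotate-residue d₁ d₂)) e)
           (λ p → ⊥-elim (m<n⇒n≢0 1≤d₁ (+-cancelʳ-≡ d₂ d₁ 0 p))) (λ p → ⊥-elim (<N⇒≢+N (+<N d₁≤ d₂≤) p))
      go (there (there (here refl))) (there (there (there ()))) _
      go (there (there (there ()))) _ _

  spokePairSquares : I → ℕ → List I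
  spokePairSquares B d₁ = rotate 1 B ∷ B ∷ rotate (suc d₁) B ∷ rotate d₁ B ∷ []

  spokePairTarget : ℕ → List I
  spokePairTarget e₂ = fzero ∷ residue (2 * n) ∷ residue (suc e₂) ∷ residue e₂ ∷ []

  spokePairSquares-unique : ∀ B d₁ → 2 ≤ d₁ → d₁ ≤ n → Unique (spokePairSquares B d₁)
  spokePairSquares-unique B d₁ 2≤d₁ d₁≤ = unique₄ (rotate-≢ B 1<N 0<N (λ ())) (rotate-≢ B 1<N sd₁< (λ e → <⇒≢ 1≤d₁ (suc-injective e)))
      (rotate-≢ B 1<N d₁< (λ e → >⇒≢ 2≤d₁ (sym e))) (rotate-≢ B 0<N sd₁< (λ ())) (rotate-≢ B 0<N d₁< (<⇒≢ 1≤d₁))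
      (rotate-≢ B sd₁< d₁< (λ e → <⇒≢ (n<1+n d₁) (sym e)))
    where
      d₁< : d₁ < N n
      d₁< = ≤n⇒<N d₁≤
      sd₁< : suc d₁ < N n
      sd₁< = ≤n⇒suc<N d₁≤
      1≤d₁ : 1 ≤ d₁
      1≤d₁ = ≤-trans (s≤s z≤n) 2≤d₁

  spokePair-gap-unique : ∀ B d₁ e₂ → 2 ≤ d₁ → d₁ ≤ n → 1 ≤ e₂ → suc e₂ ≤ n
    → (∀ k → mult₂ (spokePairSquares B d₁) k ≡ mult₂ (spokePairTarget e₂) k) → d₁ ≡ suc e₂
  spokePair-gap-unique B d₁ e₂ 2≤d₁ d₁≤ 1≤e₂ se₂≤ H = go (tr (there (here refl))) (tr (here refl)) (tr (there (there (here refl)))) (tr (there (there (there (here refl)))))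
    where
      d₁< : d₁ < N n
      d₁< = ≤n⇒<N d₁≤
      e₂≤ : e₂ ≤ n
      e₂≤ = ≤-trans (n≤1+n e₂) se₂≤
      e₂< : e₂ < N n
      e₂< = ≤n⇒<N e₂≤
      se₂< : suc e₂ < N n
      se₂< = ≤n⇒<N se₂≤
      sse₂< : suc (suc e₂) < N n
      sse₂< = ≤n⇒suc<N se₂≤
      1≤d₁ : 1 ≤ d₁
      1≤d₁ = ≤-trans (s≤s z≤n) 2≤d₁
      tr : ∀ {k} → k ∈ spokePairSquares B d₁ → k ∈ spokePairTarget e₂
      tr = ∈-transfer H (spokePairSquares-unique B d₁ 2≤d₁ d₁≤)
      LT : List I
      LT = spokePairTarget e₂
      go : ∀ {B'} → B' ∈ LT → (rotate 1 B') ∈ LT → (rotate (suc d₁) B') ∈ LT → (rotate d₁ B') ∈ LT → d₁ ≡ suc e₂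
      go (here refl) (here e) _ _ = residue-cases 1 0 (<N⇒<2N 1<N) 0<N e (λ ()) (λ p → ⊥-elim (<N⇒≢+N {b = 0} 1<N p))
      go (here refl) (there (here e)) _ _ = residue-cases 1 (2 * n) (<N⇒<2N 1<N) 2n<N e (λ p → ⊥-elim (1≢2n p)) (λ p → ⊥-elim (<N⇒≢+N 1<N p))
      go (here refl) (there (there (here e))) _ _ = residue-cases 1 (suc e₂) (<N⇒<2N 1<N) se₂< e (λ p → ⊥-elim (<⇒≢ 1≤e₂ (suc-injective p))) (λ p → ⊥-elim (<N⇒≢+N {b = suc e₂} 1<N p))
      go (here refl) (there (there (there (here e)))) _ mD = residue-cases 1 e₂ (<N⇒<2N 1<N) e₂< e (λ p → go1 p mD) (λ p → ⊥-elim (<N⇒≢+N 1<N p))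
        where
          go1 : 1 ≡ e₂ → (rotate d₁ fzero) ∈ LT → d₁ ≡ suc e₂
          go1 p (here e') = residue-cases d₁ 0 (<N⇒<2N d₁<) 0<N e' (λ q → ⊥-elim (m<n⇒n≢0 1≤d₁ q)) (λ q → ⊥-elim (<N⇒≢+N {b = 0} d₁< q))
          go1 p (there (here e')) = residue-cases d₁ (2 * n) (<N⇒<2N d₁<) 2n<N e' (λ q → ⊥-elim (<⇒≢ (≤n⇒<2n d₁≤) q)) (λ q → ⊥-elim (<N⇒≢+N d₁< q))
          go1 p (there (there (here e'))) = residue-cases d₁ (suc e₂) (<N⇒<2N d₁<) se₂< e' (λ q → q) (λ q → ⊥-elim (<N⇒≢+N {b = suc e₂} d₁< q))
          go1 p (there (there (there (here e')))) = residue-cases d₁ e₂ (<N⇒<2N d₁<) e₂< e' (λ q → ⊥-elim (>⇒≢ 2≤d₁ (trans q (sym p)))) (λ q → ⊥-elim (<N⇒≢+N d₁< q))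
          go1 p (there (there (there (there ()))))
      go (here refl) (there (there (there (there ())))) _ _
      go (there (here refl)) _ mS (here e) = residue-cases (d₁ + 2 * n) 0 (+<2N d₁< 2n<N) 0<N (trans (sym (rotate-residue d₁ (2 * n))) e)
           (λ p → ⊥-elim (m<n⇒n≢0 1≤d₁ (m+n≡0⇒m≡0 d₁ p))) (λ p → ⊥-elim (>⇒≢ 2≤d₁ (+-cancelʳ-≡ (2 * n) d₁ 1 p)))
      go (there (here refl)) _ mS (there (here e)) = residue-cases (d₁ + 2 * n) (2 * n) (+<2N d₁< 2n<N) 2n<N (trans (sym (rotate-residue d₁ (2 * n))) e)
           (λ p → ⊥-elim (m<n⇒n≢0 1≤d₁ (+-cancelʳ-≡ (2 * n) d₁ 0 p))) (λ p → ⊥-elim (<⇒≢ d₁< (+-cancelʳ-≡ (2 * n) d₁ (N n) (trans p (+-comm (2 * n) (N n))))))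
      go (there (here refl)) _ mS (there (there (here e))) = residue-cases (d₁ + 2 * n) (suc e₂) (+<2N d₁< 2n<N) se₂< (trans (sym (rotate-residue d₁ (2 * n))) e)
           (λ p → ⊥-elim (+2n≢≤n {a = d₁} se₂≤ p)) (λ p → go3 (+2n≡+N⇒≡suc d₁ (suc e₂) p) mS)
        where
          v< : suc (suc (suc e₂)) + 2 * n < N n + N n
          v< = +<2N (≤n⇒2+<N se₂≤) 2n<N
          go3 : d₁ ≡ suc (suc e₂) → (rotate (suc d₁) (residue (2 * n))) ∈ LT → d₁ ≡ suc e₂
          go3 q (here e') = residue-cases (suc (suc (suc e₂)) + 2 * n) 0 v< 0<N (subst (λ z → residue (suc z + 2 * n) ≡ fzero) q (trans (sym (rotate-residue (suc d₁) (2 * n))) e'))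
            (λ ()) (λ r → ⊥-elim (0≢1+n (sym (+-cancelʳ-≡ (2 * n) (suc (suc e₂)) 0 (suc-injective r)))))
          go3 q (there (here e')) = residue-cases (suc (suc (suc e₂)) + 2 * n) (2 * n) v< 2n<N (subst (λ z → residue (suc z + 2 * n) ≡ residue (2 * n)) q (trans (sym (rotate-residue (suc d₁) (2 * n))) e'))
            (λ r → ⊥-elim (0≢1+n (sym (+-cancelʳ-≡ (2 * n) (suc (suc (suc e₂))) 0 r)))) (λ r → ⊥-elim (<⇒≢ (≤n⇒2+<N se₂≤) (+-cancelʳ-≡ (2 * n) (suc (suc (suc e₂))) (N n) (trans r (+-comm (2 * n) (N n))))))
          go3 q (there (there (here e'))) = residue-cases (suc (suc (suc e₂)) + 2 * n) (suc e₂) v< se₂< (subst (λ z → residue (suc z + 2 * n) ≡ residue (suc e₂)) q (trans (sym (rotate-residue (suc d₁) (2 * n))) e'))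
            (λ r → ⊥-elim (+2n≢≤n {a = suc (suc (suc e₂))} se₂≤ r)) (λ r → ⊥-elim (<⇒≢ (n<1+n (suc (suc e₂))) (sym (+2n≡+N⇒≡suc (suc (suc (suc e₂))) (suc e₂) r))))
          go3 q (there (there (there (here e')))) = residue-cases (suc (suc (suc e₂)) + 2 * n) e₂ v< e₂< (subst (λ z → residue (suc z + 2 * n) ≡ residue e₂) q (trans (sym (rotate-residue (suc d₁) (2 * n))) e'))
            (λ r → ⊥-elim (+2n≢≤n {a = suc (suc (suc e₂))} e₂≤ r)) (λ r → ⊥-elim (<⇒≢ (≤-trans (n<1+n (suc e₂)) (n≤1+n _)) (sym (+2n≡+N⇒≡suc (suc (suc (suc e₂))) e₂ r))))
          go3 q (there (there (there (there ()))))
      go (there (here refl)) _ mS (there (there (there (here e)))) = residue-cases (d₁ + 2 * n) e₂ (+<2N d₁< 2n<N) e₂< (trans (sym (rotate-residue d₁ (2 * n))) e)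
           (λ p → ⊥-elim (+2n≢≤n {a = d₁} e₂≤ p)) (λ p → +2n≡+N⇒≡suc d₁ e₂ p)
      go (there (here refl)) _ mS (there (there (there (there ()))))
      go (there (there (here refl))) (here e) _ _ = residue-cases (suc (suc e₂)) 0 (<N⇒<2N sse₂<) 0<N e (λ ()) (λ p → ⊥-elim (<N⇒≢+N {b = 0} sse₂< p))
      go (there (there (here refl))) (there (here e)) _ _ = residue-cases (suc (suc e₂)) (2 * n) (<N⇒<2N sse₂<) 2n<N e (λ p → ⊥-elim (<⇒≢ (≤n⇒suc<2n se₂≤) p)) (λ p → ⊥-elim (<N⇒≢+N sse₂< p))
      go (there (there (here refl))) (there (there (here e))) _ _ = residue-cases (suc (suc e₂)) (suc e₂) (<N⇒<2N sse₂<) se₂< e (λ p → ⊥-elim (<⇒≢ (n<1+n (suc e₂)) (sym p))) (λ p → ⊥-elim (<N⇒≢+N {b = suc e₂} sse₂< p))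
      go (there (there (here refl))) (there (there (there (here e)))) _ _ = residue-cases (suc (suc e₂)) e₂ (<N⇒<2N sse₂<) e₂< e (λ p → ⊥-elim (<⇒≢ (≤-trans (n<1+n e₂) (n≤1+n _)) (sym p))) (λ p → ⊥-elim (<N⇒≢+N sse₂< p))
      go (there (there (here refl))) (there (there (there (there ())))) _ _
      go (there (there (there (here refl)))) _ _ (here e) = residue-cases (d₁ + e₂) 0 (+<2N d₁< e₂<) 0<N (trans (sym (rotate-residue d₁ e₂)) e)
           (λ p → ⊥-elim (m<n⇒n≢0 1≤d₁ (m+n≡0⇒m≡0 d₁ p))) (λ p → ⊥-elim (<N⇒≢+N {b = 0} (+<N d₁≤ e₂≤) p))
      go (there (there (there (here refl)))) _ _ (there (here e)) = residue-cases (d₁ + e₂) (2 * n) (+<2N d₁< e₂<) 2n<N (trans (sym (rotate-residue d₁ e₂)) e)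
           (λ p → ⊥-elim (<⇒≢ (subst (d₁ + e₂ <_) (sym 2n≡n+n) (+-mono-≤-< d₁≤ se₂≤)) p)) (λ p → ⊥-elim (<N⇒≢+N (+<N d₁≤ e₂≤) p))
      go (there (there (there (here refl)))) _ _ (there (there (here e))) = residue-cases (d₁ + e₂) (suc e₂) (+<2N d₁< e₂<) se₂< (trans (sym (rotate-residue d₁ e₂)) e)
           (λ p → ⊥-elim (>⇒≢ 2≤d₁ (+-cancelʳ-≡ e₂ d₁ 1 p))) (λ p → ⊥-elim (<N⇒≢+N {b = suc e₂} (+<N d₁≤ e₂≤) p))
      go (there (there (there (here refl)))) _ _ (there (there (there (here e)))) = residue-cases (d₁ + e₂) e₂ (+<2N d₁< e₂<) e₂< (trans (sym (rotate-residue d₁ e₂)) e)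
           (λ p → ⊥-elim (m<n⇒n≢0 1≤d₁ (+-cancelʳ-≡ e₂ d₁ 0 p))) (λ p → ⊥-elim (<N⇒≢+N (+<N d₁≤ e₂≤) p))
      go (there (there (there (here refl)))) _ _ (there (there (there (there ()))))
      go (there (there (there (there ())))) _ _ _

  spokePairTarget-unique : ∀ e₂ → 1 ≤ e₂ → suc e₂ ≤ n → Unique (spokePairTarget e₂)
  spokePairTarget-unique e₂ 1≤e₂ se₂≤ = unique₄ (residue-≢ 0<N 2n<N (<⇒≢ (≤n⇒<2n z≤n))) (residue-≢ 0<N se₂< (λ ())) (residue-≢ 0<N e₂< (<⇒≢ 1≤e₂))
      (residue-≢ 2n<N se₂< (λ p → <⇒≢ (≤n⇒<2n se₂≤) (sym p))) (residue-≢ 2n<N e₂< (λ p → <⇒≢ (≤n⇒<2n e₂≤) (sym p)))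
      (residue-≢ se₂< e₂< (λ p → <⇒≢ (n<1+n e₂) (sym p)))
    where
      e₂≤ : e₂ ≤ n
      e₂≤ = ≤-trans (n≤1+n e₂) se₂≤
      e₂< : e₂ < N n
      e₂< = ≤n⇒<N e₂≤
      se₂< : suc e₂ < N n
      se₂< = ≤n⇒<N se₂≤

  pair≢spokePair : ∀ B d₁ e₂ → 1 ≤ e₂ → suc e₂ ≤ n → (∀ k → mult₂ (B ∷ rotate d₁ B ∷ []) k ≡ mult₂ (spokePairTarget e₂) k) → ⊥
  pair≢spokePair B d₁ e₂ 1≤e₂ se₂≤ H = three-in-pair fzero (residue (2 * n)) (residue (suc e₂)) B (rotate d₁ B)
      (residue-≢ 0<N 2n<N (<⇒≢ (≤n⇒<2n z≤n))) (residue-≢ 0<N se₂< (λ ()))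
      (residue-≢ 2n<N se₂< (λ p → <⇒≢ (≤n⇒<2n se₂≤) (sym p)))
      (tr (here refl)) (tr (there (here refl))) (tr (there (there (here refl))))
    where
      se₂< : suc e₂ < N n
      se₂< = ≤n⇒<N se₂≤
      tr : ∀ {k} → k ∈ spokePairTarget e₂ → k ∈ (B ∷ rotate d₁ B ∷ [])
      tr = ∈-transfer (λ k → sym (H k)) (spokePairTarget-unique e₂ 1≤e₂ se₂≤)

  spokePair≢pair : ∀ B d₁ d₂ → 2 ≤ d₁ → d₁ ≤ n → (∀ k → mult₂ (spokePairSquares B d₁) k ≡ mult₂ (fzero ∷ residue d₂ ∷ []) k) → ⊥
  spokePair≢pair B d₁ d₂ 2≤d₁ d₁≤ H = three-in-pair (rotate 1 B) B (rotate d₁ B) fzero (residue d₂)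
      (rotate-≢ B 1<N 0<N (λ ())) (rotate-≢ B 1<N d₁< (λ e → >⇒≢ 2≤d₁ (sym e))) (rotate-≢ B 0<N d₁< (<⇒≢ (≤-trans (s≤s z≤n) 2≤d₁)))
      (tr (here refl)) (tr (there (here refl))) (tr (there (there (there (here refl)))))
    where
      d₁< : d₁ < N n
      d₁< = ≤n⇒<N d₁≤
      tr : ∀ {k} → k ∈ spokePairSquares B d₁ → k ∈ (fzero ∷ residue d₂ ∷ [])
      tr = ∈-transfer H (spokePairSquares-unique B d₁ 2≤d₁ d₁≤)

  mult₂-twice : ∀ x k → mult₂ (x ∷ x ∷ []) k ≡ false
  mult₂-twice x k = trans (cong (⌊ k ≟F x ⌋ xor_) (xor-identityʳ _)) (xor-same ⌊ k ≟F x ⌋)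

  onOuterRim-opposite : ∀ s i j → onOuterRim (rim s i) xor onOuterRim (rim (other s) j) ≡ true
  onOuterRim-opposite outer i j = refl
  onOuterRim-opposite inner i j = refl

  onOuterRim-same : ∀ s i j → onOuterRim (rim s i) xor onOuterRim (rim s j) ≡ false
  onOuterRim-same outer i j = refl
  onOuterRim-same inner i j = refl

  mult₂-cong : ∀ {ps qs : List I} → ps ≡ qs → ∀ k → mult₂ ps k ≡ mult₂ qs k
  mult₂-cong refl k = refl

  spokePairTarget-squares : ∀ e₂ → (fzero ∷ prev fzero ∷ residue (suc e₂) ∷ prev (residue (suc e₂)) ∷ []) ≡ spokePairTarget e₂
  spokePairTarget-squares e₂ = cong (λ z → fzero ∷ residue (2 * n) ∷ residue (suc e₂) ∷ z ∷ []) (prev-next (residue e₂))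

  fzero≢residue : ∀ d → 1 ≤ d → d ≤ n → fzero ≢ residue d
  fzero≢residue d 1≤ ≤n = residue-≢ 0<N (≤n⇒<N ≤n) (<⇒≢ 1≤)

  module Injectivity (ψ : Aut n) where
    open Rigidity ψ

    h0 : I
    h0 = h fzero

    empty≢nonempty : ∀ x ys y → Unique ys → y ∈ ys → (∀ k → mult₂ (x ∷ x ∷ []) k ≡ mult₂ ys k) → ⊥
    empty≢nonempty x ys y u y∈ys same = f≢t (trans (sym (mult₂-twice x y)) (trans (same y) (mult₂-complete u y∈ys)))

    -- The image squares of the representatives, brought into the shapes the gap lemmas compare.
    record Shapes (r : I → I) : Set where
      field
        pairShape       : ∀ δ → Σ I λ B → ∀ k → mult₂ (r fzero ∷ r (residue δ) ∷ []) k ≡ mult₂ (B ∷ rotate δ B ∷ []) k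
        spokePairShape  : ∀ δ → Σ I λ B → ∀ k → mult₂ (h0 ∷ prev h0 ∷ h (residue δ) ∷ prev (h (residue δ)) ∷ []) k
                                                  ≡ mult₂ (spokePairSquares B δ) k
        spokeRim-unique : ∀ {d₁ d₂} → 1 ≤ d₁ → d₁ ≤ n → 1 ≤ d₂ → d₂ ≤ n →
                          (∀ k → mult₂ (h0 ∷ prev h0 ∷ r (residue d₁) ∷ []) k ≡ mult₂ (fzero ∷ residue (2 * n) ∷ residue d₂ ∷ []) k) → d₁ ≡ d₂

    module _ {r : I → I} (S : Shapes r) where
      open Shapes S
      open Invariants

      classes-unique : ∀ c₁ c₂ → Valid c₁ → Valid c₂ →
        Invariants (image r (proj₁ (edgesOf c₁))) (image r (proj₂ (edgesOf c₁))) (proj₁ (edgesOf c₂)) (proj₂ (edgesOf c₂)) → c₁ ≡ c₂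
      classes-unique (oppositeRims at zero) (oppositeRims at zero) _ _ V = refl
      classes-unique (oppositeRims at zero) (oppositeRims at suc d₂) _ v₂ V =
        ⊥-elim (empty≢nonempty (r fzero) _ fzero (unique₂ (fzero≢residue (suc d₂) (s≤s z≤n) v₂)) (here refl) (oddSquares V))
      classes-unique (oppositeRims at suc d₁) (oppositeRims at zero) v₁ _ V with pairShape (suc d₁)
      ... | B , shape = ⊥-elim (empty≢nonempty fzero _ B (unique₂ (rotate-≢ B 0<N (≤n⇒<N v₁) (λ ()))) (here refl)
                                  (λ k → sym (trans (sym (shape k)) (oddSquares V k))))
      classes-unique (oppositeRims at suc d₁) (oppositeRims at suc d₂) v₁ v₂ V with pairShape (suc d₁)
      ... | B , shape = cong (oppositeRims at_) (pair-gap-unique B (suc d₁) (suc d₂) (s≤s z≤n) v₁ (s≤s z≤n) v₂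
                               (λ k → trans (sym (shape k)) (oddSquares V k)))
      classes-unique (oppositeRims at _) (spokeAndRim at _) _ _ V = ⊥-elim (f≢t (oddLengths V))
      classes-unique (oppositeRims at _) (sameRim at _) _ _ V = ⊥-elim (f≢t (trans (sym (outerRims V)) (onOuterRim-opposite side₀ _ _)))
      classes-unique (oppositeRims at _) (twoSpokes at _) _ _ V = ⊥-elim (f≢t (trans (sym (outerRims V)) (onOuterRim-opposite side₀ _ _)))
      classes-unique (spokeAndRim at _) (oppositeRims at _) _ _ V = ⊥-elim (f≢t (sym (oddLengths V)))
      classes-unique (spokeAndRim at d₁) (spokeAndRim at d₂) (1≤d₁ , d₁≤n) (1≤d₂ , d₂≤n) V =
        cong (spokeAndRim at_) (spokeRim-unique 1≤d₁ d₁≤n 1≤d₂ d₂≤n (oddSquares V))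
      classes-unique (spokeAndRim at _) (sameRim at _) _ _ V = ⊥-elim (f≢t (sym (oddLengths V)))
      classes-unique (spokeAndRim at _) (twoSpokes at _) _ _ V = ⊥-elim (f≢t (sym (oddLengths V)))
      classes-unique (sameRim at _) (oppositeRims at _) _ _ V = ⊥-elim (f≢t (trans (sym (onOuterRim-same side₀ _ _)) (outerRims V)))
      classes-unique (sameRim at _) (spokeAndRim at _) _ _ V = ⊥-elim (f≢t (oddLengths V))
      classes-unique (sameRim at d₁) (sameRim at d₂) (2≤d₁ , d₁≤n) (2≤d₂ , d₂≤n) V with pairShape d₁
      ... | B , shape = cong (sameRim at_) (pair-gap-unique B d₁ d₂ (≤-trans (s≤s z≤n) 2≤d₁) d₁≤n (≤-trans (s≤s z≤n) 2≤d₂) d₂≤n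
                          (λ k → trans (sym (shape k)) (oddSquares V k)))
      classes-unique (sameRim at d₁) (twoSpokes at suc e₂) _ (s≤s 1≤e₂ , e₂<n) V with pairShape d₁
      ... | B , shape = ⊥-elim (pair≢spokePair B d₁ e₂ 1≤e₂ e₂<n
                          (λ k → trans (sym (shape k)) (trans (oddSquares V k) (mult₂-cong (spokePairTarget-squares e₂) k))))
      classes-unique (twoSpokes at _) (oppositeRims at _) _ _ V = ⊥-elim (f≢t (outerRims V))
      classes-unique (twoSpokes at _) (spokeAndRim at _) _ _ V = ⊥-elim (f≢t (oddLengths V))
      classes-unique (twoSpokes at d₁) (sameRim at d₂) (2≤d₁ , d₁≤n) _ V with spokePairShape d₁
      ... | B , shape = ⊥-elim (spokePair≢pair B d₁ d₂ 2≤d₁ d₁≤n (λ k → trans (sym (shape k)) (oddSquares V k)))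
      classes-unique (twoSpokes at d₁) (twoSpokes at suc e₂) (2≤d₁ , d₁≤n) (s≤s 1≤e₂ , e₂<n) V with spokePairShape d₁
      ... | B , shape = cong (twoSpokes at_) (spokePair-gap-unique B d₁ e₂ 2≤d₁ d₁≤n 1≤e₂ e₂<n
                          (λ k → trans (sym (shape k)) (trans (oddSquares V k) (mult₂-cong (spokePairTarget-squares e₂) k))))

    increasing-shapes : Increasing → Shapes h
    increasing-shapes inc = record
      { pairShape       = λ δ → h0 , mult₂-cong (cong (λ x → h0 ∷ x ∷ []) (hᵢ δ))
      ; spokePairShape  = λ δ → prev h0 , mult₂-cong (cong₂ (λ x y → x ∷ prev h0 ∷ y) (sym (next-prev h0))
                                  (cong₂ (λ x y → x ∷ y ∷ []) (hᵢ′ δ) (trans (cong prev (hᵢ′ δ)) (prev-next _))))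
      ; spokeRim-unique = λ {d₁} 1≤d₁ d₁≤n 1≤d₂ d₂≤n same → spokeRim-gapᴵ (prev h0) _ _ 1≤d₁ d₁≤n 1≤d₂ d₂≤n
                            (λ k → trans (mult₂-cong (cong₂ (λ x y → x ∷ prev h0 ∷ y ∷ []) (next-prev h0) (sym (hᵢ′ d₁))) k) (same k)) }
      where
        hᵢ : ∀ t → h (residue t) ≡ rotate t h0
        hᵢ = h-increasing inc
        hᵢ′ : ∀ t → h (residue t) ≡ rotate (suc t) (prev h0)
        hᵢ′ t = trans (hᵢ t) (trans (cong (rotate t) (sym (next-prev h0))) (rotate-comm t 1 (prev h0)))

    decreasing-shapes : Decreasing → Shapes (prev ∘ h)
    decreasing-shapes dec = record
      { pairShape       = λ δ → base δ , λ k → trans (mult₂-cong (cong (λ x → x ∷ base δ ∷ []) (h0-prev δ)) k)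
                                                      (mult₂-++-comm (rotate δ (base δ) ∷ []) (base δ ∷ []) k)
      ; spokePairShape  = λ δ → base δ , λ k → trans (mult₂-cong (cong₂ _∷_ (h0-base δ) (cong₂ _∷_ (h0-prev δ)
                                                   (cong (λ x → x ∷ base δ ∷ []) (sym (next-prev _))))) k)
                                                 (mult₂-++-comm (rotate (suc δ) (base δ) ∷ rotate δ (base δ) ∷ []) (rotate 1 (base δ) ∷ base δ ∷ []) k)
      ; spokeRim-unique = λ {d₁} 1≤d₁ d₁≤n 1≤d₂ d₂≤n same → spokeRim-gapᴰ (base d₁) _ _ 1≤d₁ d₁≤n 1≤d₂ d₂≤n
                            (λ k → trans (mult₂-cong (cong₂ (λ x y → x ∷ y ∷ base d₁ ∷ []) (sym (h0-base d₁)) (sym (h0-prev d₁))) k) (same k)) }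
      where
        base : ℕ → I
        base t = prev (h (residue t))
        h0-base : ∀ t → h0 ≡ rotate (suc t) (base t)
        h0-base t = trans (sym (h-decreasing dec t)) (trans (cong (rotate t) (sym (next-prev (h (residue t))))) (rotate-comm t 1 (base t)))
        h0-prev : ∀ t → prev h0 ≡ rotate t (base t)
        h0-prev t = trans (cong prev (h0-base t)) (prev-next (rotate t (base t)))

  representative-invariants : ∀ {c₁ c₂} (v₁ : Valid c₁) (v₂ : Valid c₂) (ψ : Aut n) {im} → MapsEdges ψ im →
    SwitchEq (applyAut ψ (sigOf (representative c₁ v₁))) (sigOf (representative c₂ v₂)) →
    Invariants (im (proj₁ (edgesOf c₁))) (im (proj₂ (edgesOf c₁))) (proj₁ (edgesOf c₂)) (proj₂ (edgesOf c₂))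
  representative-invariants {c₁} {c₂} v₁ v₂ ψ ok sw = invariants
    (Disjoint⇒≢ (Disjoint-image ψ ok (edgesOf-disjoint c₁ v₁))) (Disjoint⇒≢ (edgesOf-disjoint c₂ v₂))
    (λ x y → trans (sigOf-matching (edgesOf-disjoint c₁ v₁) (fromᴬ ψ x) (fromᴬ ψ y)) (applyAut-matchingSig ψ ok _ _ x y))
    (sigOf-matching (edgesOf-disjoint c₂ v₂)) sw

  representative-injective : ∀ c₁ c₂ (v₁ : Valid c₁) (v₂ : Valid c₂) →
    SwitchIso (sigOf (representative c₁ v₁)) (sigOf (representative c₂ v₂)) → c₁ ≡ c₂
  representative-injective c₁ c₂ v₁ v₂ (ψ , sw) = by-orientation orientation
    where
      open Rigidity ψ
      open Injectivity ψ
      by-orientation : Increasing ⊎ Decreasing → c₁ ≡ c₂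
      by-orientation (inj₁ inc) = classes-unique (increasing-shapes inc) c₁ c₂ v₁ v₂ (representative-invariants v₁ v₂ ψ (image-increasing inc) sw)
      by-orientation (inj₂ dec) = classes-unique (decreasing-shapes dec) c₁ c₂ v₁ v₂ (representative-invariants v₁ v₂ ψ (image-decreasing dec) sw)

  classes : Fin (4 * n ∸ 1) → Matching2 n
  classes t = representative (decode (toℕ t)) (decode-valid (toℕ t) (toℕ<n t))

  classes-cover : ∀ (M : Matching2 n) → Σ[ i ∈ Fin (4 * n ∸ 1) ] SwitchIso (sigOf M) (sigOf (classes i))
  classes-cover M with classify M
  ... | c , v , ψ , vs , e = i , ψ , vs , λ x y → trans (e x y) (sym (classes-i x y))
    where
      i : Fin (4 * n ∸ 1)
      i = fromℕ< (encode-bound c v)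
      decode-i : decode (toℕ i) ≡ c
      decode-i = trans (cong decode (toℕ-fromℕ< (encode-bound c v))) (decode-encode c v)
      classes-i : sigOf (classes i) ≐ classSig c
      classes-i x y = trans (sigOf-matching (edgesOf-disjoint (decode (toℕ i)) (decode-valid (toℕ i) (toℕ<n i))) x y)
                            (cong (λ c′ → classSig c′ x y) decode-i)

  classes-distinct : ∀ (i j : Fin (4 * n ∸ 1)) → SwitchIso (sigOf (classes i)) (sigOf (classes j)) → i ≡ j
  classes-distinct i j iso = toℕ-injective (begin
    toℕ i                     ≡⟨ encode-decode (toℕ i) ⟨
    encode (decode (toℕ i))   ≡⟨ cong encode (representative-injective (decode (toℕ i)) (decode (toℕ j)) (decode-valid (toℕ i) (toℕ<n i)) (decode-valid (toℕ j) (toℕ<n j)) iso) ⟩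
    encode (decode (toℕ j))   ≡⟨ encode-decode (toℕ j) ⟩
    toℕ j                     ∎)
    where open ≡-Reasoning

theorem10 : (n : ℕ) → 4 ≤ n →
    Σ[ rep ∈ (Fin (4 * n ∸ 1) → Matching2 n) ]
    ((∀ (M : Matching2 n) → Σ[ i ∈ Fin (4 * n ∸ 1) ] SwitchIso (sigOf M) (sigOf (rep i)))
    × (∀ (i j : Fin (4 * n ∸ 1)) → SwitchIso (sigOf (rep i)) (sigOf (rep j)) → i ≡ j))
theorem10 n 4≤n = classes , classes-cover , classes-distinct
  where open Classification n (≤-trans (s≤s (s≤s z≤n)) 4≤n)
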